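{- $T_{\log}$ does not have the Steinitz exchange property.
   Context: Asymptotic couples $(\Gamma,\psi)$: $\Gamma$ an ordered abelian group, $\psi:\Gamma\setminus\{0\}\to\Gamma$ with (AC1) $\alpha+\beta\ne0\Rightarrow\psi(\alpha+\beta)\ge\min(\psi\alpha,\psi\beta)$, (AC2) $\psi(r\alpha)=\psi\alpha$ for $r\in\mathbb{Z}\setminus\{0\}$, (AC3) $\alpha>0\Rightarrow\alpha+\psi\alpha>\psi\beta$; $H$-type: $0<\alpha\le\beta\Rightarrow\psi\alpha\ge\psi\beta$. $\alpha'=\alpha+\psi(\alpha)$; asymptotic integration: each $\gamma$ equals $\beta'$ for a unique $\beta\ne0$, written $\int\gamma$; $s(\gamma)=\psi(\int\gamma)$; $\Psi=\psi(\Gamma\setminus\{0\})$. $T_{\log}$ is the theory, in the language $\{0,+,-,<,\psi,\infty,s,p,\delta_1,\delta_2,\dots\}$, of divisible $H$-type asymptotic couples with asymptotic integration such that $\Psi$ has least element $s0>0$, each $\alpha\in\Psi$ has immediate successor $s\alpha$ in $\Psi$, $s:\Psi\to\Psi^{>s0}$ is bijective, $p$ is its inverse (value $\infty$ outside $\Psi^{>s0}$), $\delta_n$ is division by $n$, and $\psi(0)=\infty$; it is complete. In a monster model $\mathbb{M}$, $a$ is algebraic over a parameter set $A$ if $a$ lies in a finite $A$-definable set; $\mathrm{acl}(A)$ is the set of such $a$. $T$ has the Steinitz exchange property if for all $A$ and $a,b\in\mathbb{M}$ with $a,b\notin\mathrm{acl}(A)$: $a\in\mathrm{acl}(A\cup\{b\})\iff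 b\in\mathrm{acl}(A\cup\{a\})$. -}

module Defs where

open import Data.Nat using (ℕ; zero; suc)
open import Data.Integer using (ℤ; +_; -[1+_])
open import Data.Fin using (Fin; zero; suc)
open import Data.Maybe using (Maybe; just; nothing)
open import Data.List using (List)
open import Data.List.Membership.Propositional using (_∈_)
open import Data.Product using (Σ; _×_; _,_)
open import Data.Sum using (_⊎_)
open import Data.Unit using (⊤)
open import Data.Empty using (⊥)
open import Relation.Nullary using (¬_)
open import Relation.Binary.PropositionalEquality using (_≡_; _≢_)

-- The value group Γ is a type; the structure's universe
-- is Γ∞ = Maybe Γ, with  nothing  playing the role of ∞.
-- ψ and p may take the value ∞, so they land in Maybe Γ.
-- δ n  is the function symbol δ_{n+1}  (division by n+1).

record LlogRaw : Set₁ where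
  infixl 6 _+_
  infix 4 _<_
  field
    Γ   : Set
    0g  : Γ
    _+_ : Γ → Γ → Γ
    -_  : Γ → Γ
    _<_ : Γ → Γ → Set
    ψ   : Γ → Maybe Γ
    s   : Γ → Γ
    p   : Γ → Maybe Γ
    δ   : ℕ → Γ → Γ

module RawDefs (R : LlogRaw) where
  open LlogRaw R

  _≤_ : Γ → Γ → Set
  a ≤ b = a < b ⊎ a ≡ b

  _≤∞_ : Maybe Γ → Maybe Γ → Set
  _ ≤∞ nothing = ⊤
  nothing ≤∞ just _ = ⊥
  just a ≤∞ just b = a ≤ b

  natMul : ℕ → Γ → Γ
  natMul zero x = 0g
  natMul (suc n) x = x + natMul n x

  zMul : ℤ → Γ → Γ
  zMul (+ n) x = natMul n x
  zMul -[1+ n ] x = - natMul (suc n) x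

  -- β is an asymptotic integral of γ:  β ≠ 0 and β' = β + ψ(β) = γ
  IsInt : Γ → Γ → Set
  IsInt γ β = β ≢ 0g × Σ Γ (λ c → ψ β ≡ just c × β + c ≡ γ)

  InΨ : Γ → Set
  InΨ x = Σ Γ (λ α → α ≢ 0g × ψ α ≡ just x)

module _ (R : LlogRaw) where
  open LlogRaw R
  open RawDefs R

  record IsTlog : Set where
    field
      +-assoc    : ∀ x y z → (x + y) + z ≡ x + (y + z)
      +-comm     : ∀ x y → x + y ≡ y + x
      +-identity : ∀ x → 0g + x ≡ x
      +-inverse  : ∀ x → (- x) + x ≡ 0g
      <-irrefl   : ∀ x → ¬ (x < x)
      <-trans    : ∀ x y z → x < y → y < z → x < z
      <-tri      : ∀ x y → x < y ⊎ x ≡ y ⊎ y < x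
      <-+        : ∀ x y z → x < y → x + z < y + z
      δ-div      : ∀ n x → natMul (suc n) (δ n x) ≡ x
      ψ-0        : ψ 0g ≡ nothing
      ψ-fin      : ∀ α → α ≢ 0g → Σ Γ (λ c → ψ α ≡ just c)
      AC1 : ∀ α β → α ≢ 0g → β ≢ 0g → α + β ≢ 0g →
            (ψ α ≤∞ ψ (α + β)) ⊎ (ψ β ≤∞ ψ (α + β))
      AC2 : ∀ (r : ℤ) α → r ≢ + 0 → α ≢ 0g → ψ (zMul r α) ≡ ψ α
      AC3 : ∀ α β a b → 0g < α → β ≢ 0g → ψ α ≡ just a → ψ β ≡ just b →
            b < α + a
      Htype : ∀ α β → 0g < α → α ≤ β → ψ β ≤∞ ψ α
      int-exists : ∀ γ → Σ Γ (IsInt γ)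
      int-unique : ∀ γ β β₁ → IsInt γ β → IsInt γ β₁ → β ≡ β₁
      s-def : ∀ γ β → IsInt γ β → ψ β ≡ just (s γ)
      s0-pos   : 0g < s 0g
      s0-least : ∀ x → InΨ x → s 0g ≤ x
      s-succ-in  : ∀ α → InΨ α → InΨ (s α)
      s-succ-gt  : ∀ α → InΨ α → α < s α
      s-succ-imm : ∀ α x → InΨ α → InΨ x → α < x → s α ≤ x
      s-inj  : ∀ α β → InΨ α → InΨ β → s α ≡ s β → α ≡ β
      s-surj : ∀ y → InΨ y → s 0g < y → Σ Γ (λ x → InΨ x × s x ≡ y)
      p-inv  : ∀ x → InΨ x → p (s x) ≡ just x
      p-out  : ∀ y → ¬ (InΨ y × s 0g < y) → p y ≡ nothing

record TlogModel : Set₁ where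
  field
    raw    : LlogRaw
    isTlog : IsTlog raw
  open LlogRaw raw public

data Term (n : ℕ) : Set where
  var    : Fin n → Term n
  `0     : Term n
  `∞     : Term n
  _`+_   : Term n → Term n → Term n
  `-_    : Term n → Term n
  `ψ     : Term n → Term n
  `s     : Term n → Term n
  `p     : Term n → Term n
  `δ     : ℕ → Term n → Term n     -- `δ n t  is  δ_{n+1}(t)

data Formula : ℕ → Set where
  `⊥    : ∀ {n} → Formula n
  _`≈_  : ∀ {n} → Term n → Term n → Formula n
  _`<_  : ∀ {n} → Term n → Term n → Formula n
  _`∧_  : ∀ {n} → Formula n → Formula n → Formula n
  _`∨_  : ∀ {n} → Formula n → Formula n → Formula n
  _`⇒_  : ∀ {n} → Formula n → Formula n → Formula n
  `¬_   : ∀ {n} → Formula n → Formula n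
  `∀_   : ∀ {n} → Formula (suc n) → Formula n
  `∃_   : ∀ {n} → Formula (suc n) → Formula n

-- Semantics in the L_log-structure Γ∞ of a model
-- (conventions: ∞ > Γ, and every function symbol sends ∞ to ∞)

module Semantics (M : TlogModel) where
  open TlogModel M

  Carrier : Set
  Carrier = Maybe Γ

  Env : ℕ → Set
  Env n = Fin n → Carrier

  _∷ₑ_ : ∀ {n} → Carrier → Env n → Env (suc n)
  (x ∷ₑ ρ) zero = x
  (x ∷ₑ ρ) (suc i) = ρ i

  add∞ : Carrier → Carrier → Carrier
  add∞ (just a) (just b) = just (a + b)
  add∞ _ _ = nothing

  lift∞ : (Γ → Γ) → Carrier → Carrier
  lift∞ f (just a) = just (f a)
  lift∞ f nothing = nothing

  bind∞ : (Γ → Maybe Γ) → Carrier → Carrier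
  bind∞ f (just a) = f a
  bind∞ f nothing = nothing

  lt∞ : Carrier → Carrier → Set
  lt∞ (just a) (just b) = a < b
  lt∞ (just a) nothing = ⊤
  lt∞ nothing _ = ⊥

  ⟦_⟧ : ∀ {n} → Term n → Env n → Carrier
  ⟦ var i ⟧ ρ = ρ i
  ⟦ `0 ⟧ ρ = just 0g
  ⟦ `∞ ⟧ ρ = nothing
  ⟦ t `+ u ⟧ ρ = add∞ (⟦ t ⟧ ρ) (⟦ u ⟧ ρ)
  ⟦ `- t ⟧ ρ = lift∞ -_ (⟦ t ⟧ ρ)
  ⟦ `ψ t ⟧ ρ = bind∞ ψ (⟦ t ⟧ ρ)
  ⟦ `s t ⟧ ρ = lift∞ s (⟦ t ⟧ ρ)
  ⟦ `p t ⟧ ρ = bind∞ p (⟦ t ⟧ ρ)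
  ⟦ `δ k t ⟧ ρ = lift∞ (δ k) (⟦ t ⟧ ρ)

  Sat : ∀ {n} → Formula n → Env n → Set
  Sat `⊥ ρ = ⊥
  Sat (t `≈ u) ρ = ⟦ t ⟧ ρ ≡ ⟦ u ⟧ ρ
  Sat (t `< u) ρ = lt∞ (⟦ t ⟧ ρ) (⟦ u ⟧ ρ)
  Sat (φ `∧ χ) ρ = Sat φ ρ × Sat χ ρ
  Sat (φ `∨ χ) ρ = Sat φ ρ ⊎ Sat χ ρ
  Sat (φ `⇒ χ) ρ = Sat φ ρ → Sat χ ρ
  Sat (`¬ φ) ρ = ¬ Sat φ ρ
  Sat (`∀ φ) ρ = (x : Carrier) → Sat φ (x ∷ₑ ρ)
  Sat (`∃ φ) ρ = Σ Carrier (λ x → Sat φ (x ∷ₑ ρ))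

  Subset : Set₁
  Subset = Carrier → Set

  _∪｛_｝ : Subset → Carrier → Subset
  (A ∪｛ b ｝) x = A x ⊎ x ≡ b

  acl : Subset → Carrier → Set
  acl A a =
    Σ ℕ λ k → Σ (Formula (suc k)) λ φ → Σ (Env k) λ ps →
      ((i : Fin k) → A (ps i)) ×
      Sat φ (a ∷ₑ ps) ×
      Σ (List Carrier) (λ xs → ∀ x → Sat φ (x ∷ₑ ps) → x ∈ xs)

  Exchange : Set₁
  Exchange = ∀ (A : Subset) (a b : Carrier) → ¬ acl A a → ¬ acl A b →
    (acl (A ∪｛ b ｝) a → acl (A ∪｛ a ｝) b) × (acl (A ∪｛ a ｝) b → acl (A ∪｛ b ｝) a)

TlogHasExchange : Set₁
TlogHasExchange = ∀ (M : TlogModel) → Semantics.Exchange M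

-- Take for the value group the rational step functions on the ordered index set ω + ℤ + ℤ that have finitely
-- many jumps and vanish at the top, ordered lexicographically, with ψ(x) the indicator function of the initial
-- segment ending at the first index where x is nonzero; this is a model of T_log. Translating either copy of ℤ
-- by one is an automorphism. Let b be the sum of the indicator functions of the points 0 of the two copies and
-- a = ψ(b), so that a ∈ acl(b). The translation of the second copy fixes a but moves b along an infinite,
-- strictly decreasing orbit, so b ∉ acl(a); the translations show in the same way that a, b ∉ acl(∅).
module Submission where

open import Defs
open import Relation.Nullary using (¬_)

open import Data.Bool using (Bool; true; false; not; T; if_then_else_)
open import Data.Bool.Properties using (T-irrelevant)
open import Data.Empty using (⊥; ⊥-elim)
open import Data.Fin using (toℕ) renaming (zero to fzero; suc to fsuc)
import Data.Fin.Properties as FinP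
open import Data.List using (List; []; _∷_; length; lookup; foldr; map; replicate)
import Data.List.Properties as ListP
open import Data.List.Membership.Propositional using (_∈_)
open import Data.List.Relation.Unary.Any using (here; index)
open import Data.List.Relation.Unary.Any.Properties using (lookup-index)
open import Data.Maybe as Maybe using (Maybe; just; nothing)
open import Data.Maybe.Properties using (just-injective)
open import Data.Nat as ℕ using (ℕ; zero; suc; z≤n; s≤s)
open import Data.Integer as ℤ using (ℤ; +_; -[1+_]; +<+; -<+; -<-; +≤+; -≤+; -≤-)
import Data.Integer.Properties as ℤP
open import Data.Nat.GeneralisedArithmetic using (fold)
import Data.Nat.Properties as ℕP
open import Data.Rational as ℚ using (ℚ; 0ℚ; 1ℚ)
import Data.Rational.Properties as ℚP
open import Algebra.Bundles using (AbelianGroup; CommutativeMonoid; CommutativeRing)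
open import Algebra.Properties.Semiring.Mult (CommutativeRing.semiring ℚP.+-*-commutativeRing)
  using (×-assoc-*) renaming (_×_ to _×ℚ_)
open import Algebra.Properties.AbelianGroup ℚP.+-0-abelianGroup using (∙-cancelʳ; //-rightDividesˡ; //-rightDividesʳ)
open import Algebra.Properties.CommutativeSemigroup
  (CommutativeMonoid.commutativeSemigroup (AbelianGroup.commutativeMonoid ℚP.+-0-abelianGroup))
  using (interchange)
open import Data.Product using (Σ; _,_; proj₁; proj₂; _×_)
open import Data.Product.Function.NonDependent.Propositional using (_×-⇔_)
open import Data.Sum as Sum using (_⊎_; inj₁; inj₂; [_,_])
open import Data.Sum.Function.Propositional using (_⊎-⇔_)
open import Data.Sum.Relation.Binary.LeftOrder
  using (_⊎-<_; ₁∼₂; ₁∼₁; ₂∼₂; ⊎-<-trichotomous; ⊎-<-transitive; ⊎-<-asymmetric)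
open import Data.Sum.Relation.Binary.Pointwise using (Pointwise-≡⇒≡; ≡⇒Pointwise-≡)
open import Data.Unit using (tt)
open import Function using (id; _∘_; _⇔_; mk⇔; Equivalence)
open import Function.Definitions using (Injective)
open import Function.Related.TypeIsomorphisms using (→-cong-⇔; ¬-cong-⇔)
open import Relation.Binary.Definitions
  using (DecidableEquality; Trichotomous; Transitive; Asymmetric; tri<; tri≈; tri>)
open import Relation.Nullary using (Dec; yes; no; does)
open import Relation.Binary.PropositionalEquality hiding ([_])

-- Automorphisms and algebraic closure

module _ {A : Set} {_≺_ : A → A → Set}
         (≺-trans : ∀ {x y z} → x ≺ y → y ≺ z → x ≺ z) (≺-irrefl : ∀ {x} → ¬ x ≺ x)
         {f : ℕ → A} (f-step : ∀ k → f k ≺ f (suc k)) where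

  chain-increasing : ∀ {i j} → i ℕ.< j → f i ≺ f j
  chain-increasing {i} {suc j} (s≤s i≤j) with ℕP.m≤n⇒m<n∨m≡n i≤j
  ... | inj₁ i<j = ≺-trans (chain-increasing i<j) (f-step j)
  ... | inj₂ refl = f-step i

  chain-injective : Injective _≡_ _≡_ f
  chain-injective {i} {j} fi≡fj with ℕP.<-cmp i j
  ... | tri< i<j _ _ = ⊥-elim (≺-irrefl (subst (_≺ f j) fi≡fj (chain-increasing i<j)))
  ... | tri≈ _ i≡j _ = i≡j
  ... | tri> _ _ j<i = ⊥-elim (≺-irrefl (subst (f j ≺_) fi≡fj (chain-increasing j<i)))

iterate-chain : ∀ {A : Set} {_≺_ : A → A → Set} {g : A → A} → (∀ {x y} → x ≺ y → g x ≺ g y) →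
                ∀ {a} → a ≺ g a → ∀ n → fold a g n ≺ fold a g (suc n)
iterate-chain g-mono a≺ga zero = a≺ga
iterate-chain {_≺_ = _≺_} {g} g-mono a≺ga (suc n) = g-mono (iterate-chain {_≺_ = _≺_} {g} g-mono a≺ga n)

injective-⊈-list : {A : Set} {g : ℕ → A} → Injective _≡_ _≡_ g → (xs : List A) → ¬ (∀ k → g k ∈ xs)
injective-⊈-list g-inj xs g∈xs
  with i , j , i<j , same-index ← FinP.pigeonhole (ℕP.n<1+n (length xs)) (λ i → index (g∈xs (toℕ i)))
  = ℕP.<-irrefl (g-inj (trans (lookup-index (g∈xs (toℕ i)))
                      (trans (cong (lookup xs) same-index) (sym (lookup-index (g∈xs (toℕ j))))))) i<j

module Automorphisms (M : TlogModel) where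
  open TlogModel M
  open IsTlog isTlog using (<-trans; <-irrefl)
  open Semantics M

  record Automorphism : Set where
    field
      f f⁻¹ : Γ → Γ
      f⁻¹-f : ∀ x → f⁻¹ (f x) ≡ x
      f-f⁻¹ : ∀ x → f (f⁻¹ x) ≡ x
      f-0   : f 0g ≡ 0g
      f-+   : ∀ x y → f (x + y) ≡ f x + f y
      f--   : ∀ x → f (- x) ≡ - f x
      f-δ   : ∀ n x → f (δ n x) ≡ δ n (f x)
      f-ψ   : ∀ x → ψ (f x) ≡ Maybe.map f (ψ x)
      f-s   : ∀ x → s (f x) ≡ f (s x)
      f-p   : ∀ x → p (f x) ≡ Maybe.map f (p x)
      f-<   : ∀ {x y} → x < y → f x < f y
      f-<⁻¹ : ∀ {x y} → f x < f y → x < y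

  module _ (σ : Automorphism) where
    open Automorphism σ

    σ̂ σ̂⁻¹ : Carrier → Carrier
    σ̂ = Maybe.map f
    σ̂⁻¹ = Maybe.map f⁻¹

    σ̂-σ̂⁻¹ : ∀ y → σ̂ (σ̂⁻¹ y) ≡ y
    σ̂-σ̂⁻¹ (just y) = cong just (f-f⁻¹ y)
    σ̂-σ̂⁻¹ nothing = refl

    σ̂-injective : Injective _≡_ _≡_ σ̂
    σ̂-injective {just x} {just y} eq = cong just (trans (sym (f⁻¹-f x)) (trans (cong f⁻¹ (just-injective eq)) (f⁻¹-f y)))
    σ̂-injective {nothing} {nothing} _ = refl

    lift∞-σ̂ : ∀ {g : Γ → Γ} → (∀ x → f (g x) ≡ g (f x)) → ∀ a → lift∞ g (σ̂ a) ≡ σ̂ (lift∞ g a)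
    lift∞-σ̂ f-g (just x) = cong just (sym (f-g x))
    lift∞-σ̂ f-g nothing = refl

    bind∞-σ̂ : ∀ {g : Γ → Maybe Γ} → (∀ x → g (f x) ≡ σ̂ (g x)) → ∀ a → bind∞ g (σ̂ a) ≡ σ̂ (bind∞ g a)
    bind∞-σ̂ f-g (just x) = f-g x
    bind∞-σ̂ f-g nothing = refl

    add∞-σ̂ : ∀ a b → add∞ (σ̂ a) (σ̂ b) ≡ σ̂ (add∞ a b)
    add∞-σ̂ (just x) (just y) = cong just (sym (f-+ x y))
    add∞-σ̂ (just x) nothing = refl
    add∞-σ̂ nothing b = refl

    lt∞-σ̂ : ∀ a b → lt∞ a b ⇔ lt∞ (σ̂ a) (σ̂ b)
    lt∞-σ̂ (just x) (just y) = mk⇔ f-< f-<⁻¹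
    lt∞-σ̂ (just x) nothing = mk⇔ id id
    lt∞-σ̂ nothing (just y) = mk⇔ id id
    lt∞-σ̂ nothing nothing = mk⇔ id id

    _≈σ̂_ : ∀ {n} → Env n → Env n → Set
    ρ ≈σ̂ ρ' = ∀ i → ρ' i ≡ σ̂ (ρ i)

    ∷-≈σ̂ : ∀ {n} {ρ ρ' : Env n} {x y} → y ≡ σ̂ x → ρ ≈σ̂ ρ' → (x ∷ₑ ρ) ≈σ̂ (y ∷ₑ ρ')
    ∷-≈σ̂ y≡σ̂x ρ≈ fzero = y≡σ̂x
    ∷-≈σ̂ y≡σ̂x ρ≈ (fsuc i) = ρ≈ i

    ⟦⟧-σ̂ : ∀ {n} (t : Term n) {ρ ρ' : Env n} → ρ ≈σ̂ ρ' → ⟦ t ⟧ ρ' ≡ σ̂ (⟦ t ⟧ ρ)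
    ⟦⟧-σ̂ (var i) ρ≈ = ρ≈ i
    ⟦⟧-σ̂ `0 ρ≈ = cong just (sym f-0)
    ⟦⟧-σ̂ `∞ ρ≈ = refl
    ⟦⟧-σ̂ (t `+ u) {ρ} ρ≈ = trans (cong₂ add∞ (⟦⟧-σ̂ t ρ≈) (⟦⟧-σ̂ u ρ≈)) (add∞-σ̂ (⟦ t ⟧ ρ) (⟦ u ⟧ ρ))
    ⟦⟧-σ̂ (`- t) {ρ} ρ≈ = trans (cong (lift∞ -_) (⟦⟧-σ̂ t ρ≈)) (lift∞-σ̂ { -_ } f-- (⟦ t ⟧ ρ))
    ⟦⟧-σ̂ (`ψ t) {ρ} ρ≈ = trans (cong (bind∞ ψ) (⟦⟧-σ̂ t ρ≈)) (bind∞-σ̂ {ψ} f-ψ (⟦ t ⟧ ρ))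
    ⟦⟧-σ̂ (`s t) {ρ} ρ≈ = trans (cong (lift∞ s) (⟦⟧-σ̂ t ρ≈)) (lift∞-σ̂ {s} (sym ∘ f-s) (⟦ t ⟧ ρ))
    ⟦⟧-σ̂ (`p t) {ρ} ρ≈ = trans (cong (bind∞ p) (⟦⟧-σ̂ t ρ≈)) (bind∞-σ̂ {p} f-p (⟦ t ⟧ ρ))
    ⟦⟧-σ̂ (`δ k t) {ρ} ρ≈ = trans (cong (lift∞ (δ k)) (⟦⟧-σ̂ t ρ≈)) (lift∞-σ̂ {δ k} (f-δ k) (⟦ t ⟧ ρ))

    Sat-σ̂ : ∀ {n} (φ : Formula n) {ρ ρ' : Env n} → ρ ≈σ̂ ρ' → Sat φ ρ ⇔ Sat φ ρ'
    Sat-σ̂ `⊥ ρ≈ = mk⇔ id id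
    Sat-σ̂ (t `≈ u) ρ≈ = mk⇔
      (λ eq → trans (⟦⟧-σ̂ t ρ≈) (trans (cong σ̂ eq) (sym (⟦⟧-σ̂ u ρ≈))))
      (λ eq → σ̂-injective (trans (sym (⟦⟧-σ̂ t ρ≈)) (trans eq (⟦⟧-σ̂ u ρ≈))))
    Sat-σ̂ (t `< u) {ρ} ρ≈ = mk⇔
      (subst₂ lt∞ (sym (⟦⟧-σ̂ t ρ≈)) (sym (⟦⟧-σ̂ u ρ≈)) ∘ Equivalence.to (lt∞-σ̂ (⟦ t ⟧ ρ) (⟦ u ⟧ ρ)))
      (Equivalence.from (lt∞-σ̂ (⟦ t ⟧ ρ) (⟦ u ⟧ ρ)) ∘ subst₂ lt∞ (⟦⟧-σ̂ t ρ≈) (⟦⟧-σ̂ u ρ≈))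
    Sat-σ̂ (φ `∧ χ) ρ≈ = Sat-σ̂ φ ρ≈ ×-⇔ Sat-σ̂ χ ρ≈
    Sat-σ̂ (φ `∨ χ) ρ≈ = Sat-σ̂ φ ρ≈ ⊎-⇔ Sat-σ̂ χ ρ≈
    Sat-σ̂ (φ `⇒ χ) ρ≈ = →-cong-⇔ (Sat-σ̂ φ ρ≈) (Sat-σ̂ χ ρ≈)
    Sat-σ̂ (`¬ φ) ρ≈ = ¬-cong-⇔ (Sat-σ̂ φ ρ≈)
    Sat-σ̂ (`∀ φ) ρ≈ = mk⇔
      (λ h y → Equivalence.to (Sat-σ̂ φ (∷-≈σ̂ (sym (σ̂-σ̂⁻¹ y)) ρ≈)) (h (σ̂⁻¹ y)))
      (λ h x → Equivalence.from (Sat-σ̂ φ (∷-≈σ̂ refl ρ≈)) (h (σ̂ x)))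
    Sat-σ̂ (`∃ φ) ρ≈ = mk⇔
      (λ (x , h) → σ̂ x , Equivalence.to (Sat-σ̂ φ (∷-≈σ̂ refl ρ≈)) h)
      (λ (y , h) → σ̂⁻¹ y , Equivalence.from (Sat-σ̂ φ (∷-≈σ̂ (sym (σ̂-σ̂⁻¹ y)) ρ≈)) h)

  Fixes : Automorphism → Subset → Set
  Fixes σ A = ∀ {c} → A c → σ̂ σ c ≡ c

  orbit-injective : ∀ (σ : Automorphism) {a} → let open Automorphism σ in
                    a < f a ⊎ f a < a → Injective _≡_ _≡_ (fold a f)
  orbit-injective σ (inj₁ a<fa) = chain-injective (λ {x} {y} {z} → <-trans x y z) (λ {x} → <-irrefl x)
    (iterate-chain {_≺_ = _<_} (Automorphism.f-< σ) a<fa)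
  orbit-injective σ (inj₂ fa<a) = chain-injective (λ {x} {y} {z} p q → <-trans z y x q p) (λ {x} → <-irrefl x)
    (iterate-chain {_≺_ = λ x y → y < x} (Automorphism.f-< σ) fa<a)

  -- every A-definable set containing a contains its whole orbit, which is infinite
  moved⇒∉acl : ∀ {A a} (σ : Automorphism) → Fixes σ A →
               let open Automorphism σ in a < f a ⊎ f a < a → ¬ acl A (just a)
  moved⇒∉acl {A} {a} σ fixes moved (k , φ , ps , ps∈A , a∈φ , xs , φ⊆xs) =
    injective-⊈-list (orbit-injective σ moved ∘ just-injective) xs (λ n → φ⊆xs _ (orbit∈φ n))
    where
    open Automorphism σ
    orbit∈φ : ∀ n → Sat φ (just (fold a f n) ∷ₑ ps)
    orbit∈φ zero = a∈φ
    orbit∈φ (suc n) = Equivalence.to (Sat-σ̂ σ φ (∷-≈σ̂ σ refl (λ i → sym (fixes (ps∈A i))))) (orbit∈φ n)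

  ψ-value∈acl : ∀ {A a b} → A (just b) → ψ b ≡ just a → acl A (just a)
  ψ-value∈acl {a = a} {b} b∈A ψb≡a =
    1 , (var fzero `≈ `ψ (var (fsuc fzero))) , (λ _ → just b) , (λ _ → b∈A) , sym ψb≡a ,
    (just a ∷ []) , (λ x x≡ψb → here (trans x≡ψb ψb≡a))

module _ {A B : Set} (_≺_ : A → A → Set) (g : A → B) (c : B) where

  FirstDeviation : A → Set
  FirstDeviation i = (∀ k → k ≺ i → g k ≡ c) × g i ≢ c

  Deviation : Set
  Deviation = Σ A FirstDeviation ⊎ (∀ k → g k ≡ c)

FirstDeviation-unique : ∀ {A B : Set} {_≺_ : A → A → Set} {g : A → B} {c i j} → Trichotomous _≡_ _≺_ →
                        FirstDeviation _≺_ g c i → FirstDeviation _≺_ g c j → i ≡ j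
FirstDeviation-unique {i = i} {j} compare (before-i , at-i) (before-j , at-j) with compare i j
... | tri< i<j _ _ = ⊥-elim (at-i (before-j i i<j))
... | tri≈ _ i≡j _ = i≡j
... | tri> _ _ j<i = ⊥-elim (at-j (before-i j j<i))

module _ {A₁ A₂ B : Set} {_<₁_ : A₁ → A₁ → Set} {_<₂_ : A₂ → A₂ → Set} {g : A₁ ⊎ A₂ → B} {c : B} where

  deviation-⊎ : Deviation _<₁_ (g ∘ inj₁) c → ((∀ a → g (inj₁ a) ≡ c) → Deviation _<₂_ (g ∘ inj₂) c) →
                Deviation (_<₁_ ⊎-< _<₂_) g c
  deviation-⊎ (inj₁ (i , before , at-i)) _ = inj₁ (inj₁ i , (λ { (inj₁ k) (₁∼₁ k<i) → before k k<i }) , at-i)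
  deviation-⊎ (inj₂ const₁) continue with continue const₁
  ... | inj₁ (j , before , at-j) =
    inj₁ (inj₂ j , (λ { (inj₁ k) ₁∼₂ → const₁ k ; (inj₂ k) (₂∼₂ k<j) → before k k<j }) , at-j)
  ... | inj₂ const₂ = inj₂ (λ { (inj₁ k) → const₁ k ; (inj₂ k) → const₂ k })

module _ {B : Set} (_≟_ : DecidableEquality B) {c : B} where

  deviation-ℕ : ∀ {g : ℕ → B} N t → (∀ k → N ℕ.≤ k → g k ≡ t) → Deviation ℕ._<_ g c
  deviation-ℕ {g} N t tail with scan (suc N)
    where
    scan : ∀ n → Σ ℕ (FirstDeviation ℕ._<_ g c) ⊎ (∀ k → k ℕ.< n → g k ≡ c)
    scan zero = inj₂ (λ k ())
    scan (suc n) with scan n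
    ... | inj₁ found = inj₁ found
    ... | inj₂ below with g n ≟ c
    ...   | no at-n = inj₁ (n , below , at-n)
    ...   | yes gn≡c = inj₂ (λ k k<1+n → [ below k , (λ { refl → gn≡c }) ] (ℕP.m<1+n⇒m<n∨m≡n k<1+n))
  ... | inj₁ found = inj₁ found
  ... | inj₂ below = inj₂ const
    where
    t≡c : t ≡ c
    t≡c = trans (sym (tail N ℕP.≤-refl)) (below N (ℕP.n<1+n N))
    const : ∀ k → g k ≡ c
    const k with k ℕ.<? suc N
    ... | yes k<1+N = below k k<1+N
    ... | no k≮1+N = trans (tail k (ℕP.<⇒≤ (ℕP.≮⇒≥ k≮1+N))) t≡c

  deviation-ℤ : ∀ {g : ℤ → B} N t → (∀ m → N ℕ.≤ m → g -[1+ m ] ≡ c) → (∀ k → N ℕ.≤ k → g (+ k) ≡ t) →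
                Deviation ℤ._<_ g c
  deviation-ℤ {g} N t neg-tail pos-tail with scan-down N neg-tail
    where
    -- on the negative half the first deviation is the one with the largest m
    scan-down : ∀ n → (∀ m → n ℕ.≤ m → g -[1+ m ] ≡ c) →
                Σ ℕ (λ m → FirstDeviation ℤ._<_ g c -[1+ m ]) ⊎ (∀ m → g -[1+ m ] ≡ c)
    scan-down zero above = inj₂ (λ m → above m z≤n)
    scan-down (suc n) above with g -[1+ n ] ≟ c
    ... | no at-n = inj₁ (n , (λ { -[1+ m ] (-<- n<m) → above m n<m }) , at-n)
    ... | yes gn≡c = scan-down n (λ m n≤m → [ above m , (λ { refl → gn≡c }) ] (ℕP.m≤n⇒m<n∨m≡n n≤m) )
  ... | inj₁ (m , first) = inj₁ (-[1+ m ] , first)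
  ... | inj₂ neg-const with deviation-ℕ {g ∘ +_} N t pos-tail
  ...   | inj₁ (m , before , at-m) =
    inj₁ (+ m , (λ { -[1+ k ] _ → neg-const k ; (+ k) (+<+ k<m) → before k k<m }) , at-m)
  ...   | inj₂ pos-const = inj₂ (λ { -[1+ k ] → neg-const k ; (+ k) → pos-const k })

-- The index set ω + ℤ + ℤ

I : Set
I = ℕ ⊎ (ℤ ⊎ ℤ)

pattern nat n = inj₁ n
pattern z₀ j = inj₂ (inj₁ j)
pattern z₁ j = inj₂ (inj₂ j)

infix 4 _<I_ _≤I_

_<I_ : I → I → Set
_<I_ = ℕ._<_ ⊎-< (ℤ._<_ ⊎-< ℤ._<_)

_≤I_ : I → I → Set
i ≤I j = i <I j ⊎ i ≡ j

⊎-<-compare : {A B : Set} {_<₁_ : A → A → Set} {_<₂_ : B → B → Set} →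
              Trichotomous _≡_ _<₁_ → Trichotomous _≡_ _<₂_ → Trichotomous _≡_ (_<₁_ ⊎-< _<₂_)
⊎-<-compare compare₁ compare₂ x y with ⊎-<-trichotomous compare₁ compare₂ x y
... | tri< x<y x≢y x≯y = tri< x<y (x≢y ∘ ≡⇒Pointwise-≡) x≯y
... | tri≈ x≮y x≡y x≯y = tri≈ x≮y (Pointwise-≡⇒≡ x≡y) x≯y
... | tri> x≮y x≢y x>y = tri> x≮y (x≢y ∘ ≡⇒Pointwise-≡) x>y

⊎-<-map-mono : ∀ {A B : Set} {_<₁_ : A → A → Set} {_<₂_ : B → B → Set} {f : A → A} {g : B → B} →
               (∀ {x y} → x <₁ y → f x <₁ f y) → (∀ {x y} → x <₂ y → g x <₂ g y) →
               ∀ {x y} → (_<₁_ ⊎-< _<₂_) x y → (_<₁_ ⊎-< _<₂_) (Sum.map f g x) (Sum.map f g y)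
⊎-<-map-mono f-mono g-mono ₁∼₂ = ₁∼₂
⊎-<-map-mono f-mono g-mono (₁∼₁ x<y) = ₁∼₁ (f-mono x<y)
⊎-<-map-mono f-mono g-mono (₂∼₂ x<y) = ₂∼₂ (g-mono x<y)

<I-compare : Trichotomous _≡_ _<I_
<I-compare = ⊎-<-compare ℕP.<-cmp (⊎-<-compare ℤP.<-cmp ℤP.<-cmp)

<I-trans : Transitive _<I_
<I-trans = ⊎-<-transitive ℕP.<-trans (⊎-<-transitive ℤP.<-trans ℤP.<-trans)

<I-asym : Asymmetric _<I_
<I-asym = ⊎-<-asymmetric ℕP.<-asym (⊎-<-asymmetric ℤP.<-asym ℤP.<-asym)

<I-irrefl : ∀ {i} → ¬ i <I i
<I-irrefl i<i = <I-asym i<i i<i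

≤<I-trans : ∀ {i j k} → i ≤I j → j <I k → i <I k
≤<I-trans (inj₁ i<j) j<k = <I-trans i<j j<k
≤<I-trans (inj₂ refl) j<k = j<k

≮I⇒≥ : ∀ {i j} → ¬ j <I i → i ≤I j
≮I⇒≥ {i} {j} j≮i with <I-compare i j
... | tri< i<j _ _ = inj₁ i<j
... | tri≈ _ i≡j _ = inj₂ i≡j
... | tri> _ _ j<i = ⊥-elim (j≮i j<i)

record IsImmediateSuccessor {A : Set} (_<_ : A → A → Set) (next : A → A) : Set where
  field
    <-next     : ∀ x → x < next x
    next-least : ∀ {x y} → x < y → next x < y ⊎ next x ≡ y

next-⊎ : ∀ {A B : Set} {_<₁_ : A → A → Set} {_<₂_ : B → B → Set} {next₁ next₂} →
         IsImmediateSuccessor _<₁_ next₁ → IsImmediateSuccessor _<₂_ next₂ →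
         IsImmediateSuccessor (_<₁_ ⊎-< _<₂_) (Sum.map next₁ next₂)
next-⊎ {_<₁_ = _<₁_} {_<₂_} {next₁} {next₂} succ₁ succ₂ = record { <-next = <-next ; next-least = next-least }
  where
  module S₁ = IsImmediateSuccessor succ₁
  module S₂ = IsImmediateSuccessor succ₂
  <-next : ∀ x → (_<₁_ ⊎-< _<₂_) x (Sum.map next₁ next₂ x)
  <-next (inj₁ a) = ₁∼₁ (S₁.<-next a)
  <-next (inj₂ b) = ₂∼₂ (S₂.<-next b)
  next-least : ∀ {x y} → (_<₁_ ⊎-< _<₂_) x y →
               (_<₁_ ⊎-< _<₂_) (Sum.map next₁ next₂ x) y ⊎ Sum.map next₁ next₂ x ≡ y
  next-least ₁∼₂ = inj₁ ₁∼₂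
  next-least (₁∼₁ a<a') = Sum.map ₁∼₁ (cong inj₁) (S₁.next-least a<a')
  next-least (₂∼₂ b<b') = Sum.map ₂∼₂ (cong inj₂) (S₂.next-least b<b')

ℕ-suc-immediate : IsImmediateSuccessor ℕ._<_ suc
ℕ-suc-immediate = record { <-next = ℕP.n<1+n ; next-least = ℕP.m≤n⇒m<n∨m≡n }

ℤ-suc-immediate : IsImmediateSuccessor ℤ._<_ ℤ.suc
ℤ-suc-immediate = record { <-next = λ i → ℤP.suc[i]≤j⇒i<j ℤP.≤-refl ; next-least = next-least }
  where
  next-least : ∀ {i j} → i ℤ.< j → ℤ.suc i ℤ.< j ⊎ ℤ.suc i ≡ j
  next-least {i} {j} i<j with ℤ.suc i ℤ.≟ j
  ... | yes 1+i≡j = inj₂ 1+i≡j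
  ... | no 1+i≢j = inj₁ (ℤP.≤∧≢⇒< (ℤP.i<j⇒suc[i]≤j i<j) 1+i≢j)

ℤ-suc-mono : ∀ {i j} → i ℤ.< j → ℤ.suc i ℤ.< ℤ.suc j
ℤ-suc-mono = ℤP.+-monoʳ-< (+ 1)

ℤ-pred-mono : ∀ {i j} → i ℤ.< j → ℤ.pred i ℤ.< ℤ.pred j
ℤ-pred-mono = ℤP.+-monoʳ-< -[1+ 0 ]

ℤ-pred-suc-comm : ∀ j → ℤ.pred (ℤ.suc j) ≡ ℤ.suc (ℤ.pred j)
ℤ-pred-suc-comm j = trans (ℤP.pred-suc j) (sym (ℤP.suc-pred j))

sucI : I → I
sucI = Sum.map suc (Sum.map ℤ.suc ℤ.suc)

sucI-immediate : IsImmediateSuccessor _<I_ sucI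
sucI-immediate = next-⊎ ℕ-suc-immediate (next-⊎ ℤ-suc-immediate ℤ-suc-immediate)

open IsImmediateSuccessor sucI-immediate using () renaming (<-next to <sucI; next-least to sucI-least)

<sucI⇒≤ : ∀ {k i} → k <I sucI i → k ≤I i
<sucI⇒≤ {k} {i} k<1+i = ≮I⇒≥ (λ i<k → [ <I-asym k<1+i , (λ { refl → <I-irrefl k<1+i }) ] (sucI-least i<k))

pred? : I → Maybe I
pred? (nat zero) = nothing
pred? (nat (suc n)) = just (nat n)
pred? (z₀ j) = just (z₀ (ℤ.pred j))
pred? (z₁ j) = just (z₁ (ℤ.pred j))

pred?-sucI : ∀ i → pred? (sucI i) ≡ just i
pred?-sucI (nat n) = refl
pred?-sucI (z₀ j) = cong (just ∘ z₀) (ℤP.pred-suc j)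
pred?-sucI (z₁ j) = cong (just ∘ z₁) (ℤP.pred-suc j)

pred?-just : ∀ {i j} → pred? j ≡ just i → sucI i ≡ j
pred?-just {j = nat (suc n)} refl = refl
pred?-just {j = z₀ j} refl = cong z₀ (ℤP.suc-pred j)
pred?-just {j = z₁ j} refl = cong z₁ (ℤP.suc-pred j)

pred?-nothing : ∀ {j} → pred? j ≡ nothing → j ≡ nat 0
pred?-nothing {nat zero} _ = refl
pred?-nothing {nat (suc n)} ()
pred?-nothing {z₀ j} ()
pred?-nothing {z₁ j} ()

sucI-injective : ∀ {i j} → sucI i ≡ sucI j → i ≡ j
sucI-injective {i} {j} eq = just-injective (trans (sym (pred?-sucI i)) (trans (cong pred? eq) (pred?-sucI j)))

nat0-≤I : ∀ i → nat 0 ≤I i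
nat0-≤I (nat zero) = inj₂ refl
nat0-≤I (nat (suc n)) = inj₁ (₁∼₁ (s≤s z≤n))
nat0-≤I (z₀ j) = inj₁ ₁∼₂
nat0-≤I (z₁ j) = inj₁ ₁∼₂

-- Finitely supported rational sequences

lookup₀ : List ℚ → ℕ → ℚ
lookup₀ [] n = 0ℚ
lookup₀ (a ∷ l) zero = a
lookup₀ (a ∷ l) (suc n) = lookup₀ l n

lookup₀-length : ∀ l {n} → length l ℕ.≤ n → lookup₀ l n ≡ 0ℚ
lookup₀-length [] _ = refl
lookup₀-length (a ∷ l) (s≤s le) = lookup₀-length l le

isZero : ℚ → Bool
isZero a = does (a ℚ.≟ 0ℚ)

-- finitely supported sequences are represented by lists without trailing zeros, making the representation unique
NoTrailingZero : List ℚ → Bool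
NoTrailingZero [] = true
NoTrailingZero (a ∷ []) = not (isZero a)
NoTrailingZero (a ∷ b ∷ l) = NoTrailingZero (b ∷ l)

_∷⁰_ : ℚ → List ℚ → List ℚ
a ∷⁰ [] = if isZero a then [] else a ∷ []
a ∷⁰ (b ∷ l) = a ∷ b ∷ l

normalise : List ℚ → List ℚ
normalise = foldr _∷⁰_ []

lookup₀-∷⁰ : ∀ a l n → lookup₀ (a ∷⁰ l) n ≡ lookup₀ (a ∷ l) n
lookup₀-∷⁰ a [] n with a ℚ.≟ 0ℚ
lookup₀-∷⁰ a [] zero | yes a≡0 = sym a≡0
lookup₀-∷⁰ a [] (suc n) | yes _ = refl
... | no _ = refl
lookup₀-∷⁰ a (b ∷ l) n = refl

lookup₀-normalise : ∀ l n → lookup₀ (normalise l) n ≡ lookup₀ l n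
lookup₀-normalise [] n = refl
lookup₀-normalise (a ∷ l) n = trans (lookup₀-∷⁰ a (normalise l) n) (lookup₀-cons n)
  where
  lookup₀-cons : ∀ n → lookup₀ (a ∷ normalise l) n ≡ lookup₀ (a ∷ l) n
  lookup₀-cons zero = refl
  lookup₀-cons (suc n) = lookup₀-normalise l n

∷⁰-NoTrailingZero : ∀ a l → T (NoTrailingZero l) → T (NoTrailingZero (a ∷⁰ l))
∷⁰-NoTrailingZero a [] _ with isZero a in a≟0
... | true = tt
... | false = subst (T ∘ not) (sym a≟0) tt
∷⁰-NoTrailingZero a (b ∷ l) ok = ok

normalise-NoTrailingZero : ∀ l → T (NoTrailingZero (normalise l))
normalise-NoTrailingZero [] = tt
normalise-NoTrailingZero (a ∷ l) = ∷⁰-NoTrailingZero a (normalise l) (normalise-NoTrailingZero l)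

NoTrailingZero-tail : ∀ a l → T (NoTrailingZero (a ∷ l)) → T (NoTrailingZero l)
NoTrailingZero-tail a [] _ = tt
NoTrailingZero-tail a (b ∷ l) ok = ok

NoTrailingZero-nonzero : ∀ a l → T (NoTrailingZero (a ∷ l)) → Σ ℕ λ n → lookup₀ (a ∷ l) n ≢ 0ℚ
NoTrailingZero-nonzero a [] ok with a ℚ.≟ 0ℚ
... | no a≢0 = zero , a≢0
NoTrailingZero-nonzero a (b ∷ l) ok with NoTrailingZero-nonzero b l ok
... | n , nonzero = suc n , nonzero

lookup₀-injective : ∀ l m → T (NoTrailingZero l) → T (NoTrailingZero m) →
                    (∀ n → lookup₀ l n ≡ lookup₀ m n) → l ≡ m
lookup₀-injective [] [] _ _ _ = refl
lookup₀-injective [] (b ∷ m) _ ok same with NoTrailingZero-nonzero b m ok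
... | n , nonzero = ⊥-elim (nonzero (sym (same n)))
lookup₀-injective (a ∷ l) [] ok _ same with NoTrailingZero-nonzero a l ok
... | n , nonzero = ⊥-elim (nonzero (same n))
lookup₀-injective (a ∷ l) (b ∷ m) okl okm same =
  cong₂ _∷_ (same zero)
    (lookup₀-injective l m (NoTrailingZero-tail a l okl) (NoTrailingZero-tail b m okm) (same ∘ suc))

FinSupp : Set
FinSupp = Σ (List ℚ) (T ∘ NoTrailingZero)

fromList : List ℚ → FinSupp
fromList l = normalise l , normalise-NoTrailingZero l

_!_ : FinSupp → ℕ → ℚ
x ! n = lookup₀ (proj₁ x) n

supportBound : FinSupp → ℕ
supportBound x = length (proj₁ x)

fromList-! : ∀ l n → fromList l ! n ≡ lookup₀ l n
fromList-! = lookup₀-normalise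

!-beyond : ∀ x {n} → supportBound x ℕ.≤ n → x ! n ≡ 0ℚ
!-beyond x = lookup₀-length (proj₁ x)

FinSupp-ext : ∀ {x y} → (∀ n → x ! n ≡ y ! n) → x ≡ y
FinSupp-ext {l , okl} {m , okm} same with lookup₀-injective l m okl okm same
... | refl = cong (l ,_) (T-irrelevant okl okm)

zipWith₀ : (ℚ → ℚ → ℚ) → List ℚ → List ℚ → List ℚ
zipWith₀ g [] [] = []
zipWith₀ g [] (b ∷ m) = g 0ℚ b ∷ zipWith₀ g [] m
zipWith₀ g (a ∷ l) [] = g a 0ℚ ∷ zipWith₀ g l []
zipWith₀ g (a ∷ l) (b ∷ m) = g a b ∷ zipWith₀ g l m

lookup₀-zipWith₀ : ∀ g → g 0ℚ 0ℚ ≡ 0ℚ → ∀ l m n → lookup₀ (zipWith₀ g l m) n ≡ g (lookup₀ l n) (lookup₀ m n)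
lookup₀-zipWith₀ g g00 [] [] n = sym g00
lookup₀-zipWith₀ g g00 [] (b ∷ m) zero = refl
lookup₀-zipWith₀ g g00 [] (b ∷ m) (suc n) = lookup₀-zipWith₀ g g00 [] m n
lookup₀-zipWith₀ g g00 (a ∷ l) [] zero = refl
lookup₀-zipWith₀ g g00 (a ∷ l) [] (suc n) = lookup₀-zipWith₀ g g00 l [] n
lookup₀-zipWith₀ g g00 (a ∷ l) (b ∷ m) zero = refl
lookup₀-zipWith₀ g g00 (a ∷ l) (b ∷ m) (suc n) = lookup₀-zipWith₀ g g00 l m n

lookup₀-map : ∀ g → g 0ℚ ≡ 0ℚ → ∀ l n → lookup₀ (map g l) n ≡ g (lookup₀ l n)
lookup₀-map g g0 [] n = sym g0
lookup₀-map g g0 (a ∷ l) zero = refl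
lookup₀-map g g0 (a ∷ l) (suc n) = lookup₀-map g g0 l n

0ₛ : FinSupp
0ₛ = [] , tt

_+ₛ_ : FinSupp → FinSupp → FinSupp
x +ₛ y = fromList (zipWith₀ ℚ._+_ (proj₁ x) (proj₁ y))

-ₛ_ : FinSupp → FinSupp
-ₛ x = fromList (map ℚ.-_ (proj₁ x))

_*ₛ_ : ℚ → FinSupp → FinSupp
c *ₛ x = fromList (map (c ℚ.*_) (proj₁ x))

+ₛ-! : ∀ x y n → (x +ₛ y) ! n ≡ x ! n ℚ.+ y ! n
+ₛ-! x y n = trans (fromList-! (zipWith₀ ℚ._+_ (proj₁ x) (proj₁ y)) n) (lookup₀-zipWith₀ ℚ._+_ refl (proj₁ x) (proj₁ y) n)

-ₛ-! : ∀ x n → (-ₛ x) ! n ≡ ℚ.- (x ! n)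
-ₛ-! x n = trans (fromList-! (map ℚ.-_ (proj₁ x)) n) (lookup₀-map ℚ.-_ refl (proj₁ x) n)

*ₛ-! : ∀ c x n → (c *ₛ x) ! n ≡ c ℚ.* x ! n
*ₛ-! c x n = trans (fromList-! (map (c ℚ.*_) (proj₁ x)) n) (lookup₀-map (c ℚ.*_) (ℚP.*-zeroʳ c) (proj₁ x) n)

replicateₛ : ℕ → ℚ → FinSupp
replicateₛ k c = fromList (replicate k c)

replicateₛ-!-< : ∀ {k n} c → n ℕ.< k → replicateₛ k c ! n ≡ c
replicateₛ-!-< {k} {n} c n<k = trans (fromList-! (replicate k c) n) (lookup₀-replicate k n n<k)
  where
  lookup₀-replicate : ∀ k n → n ℕ.< k → lookup₀ (replicate k c) n ≡ c
  lookup₀-replicate (suc k) zero _ = refl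
  lookup₀-replicate (suc k) (suc n) (s≤s n<k) = lookup₀-replicate k n n<k

replicateₛ-!-≥ : ∀ {k n} c → k ℕ.≤ n → replicateₛ k c ! n ≡ 0ℚ
replicateₛ-!-≥ {k} {n} c k≤n =
  trans (fromList-! (replicate k c) n) (lookup₀-length (replicate k c) (subst (ℕ._≤ n) (sym (ListP.length-replicate k)) k≤n))

_∷ₛ_ : ℚ → FinSupp → FinSupp
a ∷ₛ x = fromList (a ∷ proj₁ x)

tailₛ : FinSupp → FinSupp
tailₛ ([] , _) = 0ₛ
tailₛ (a ∷ l , _) = fromList l

∷ₛ-!-zero : ∀ a x → (a ∷ₛ x) ! 0 ≡ a
∷ₛ-!-zero a x = fromList-! (a ∷ proj₁ x) 0

∷ₛ-!-suc : ∀ a x n → (a ∷ₛ x) ! suc n ≡ x ! n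
∷ₛ-!-suc a x n = fromList-! (a ∷ proj₁ x) (suc n)

tailₛ-! : ∀ x n → tailₛ x ! n ≡ x ! suc n
tailₛ-! ([] , _) n = refl
tailₛ-! (a ∷ l , _) n = fromList-! l n

-- The value group: rational step functions on the index set

offset : FinSupp → ℚ → ℕ → ℚ
offset x t n = x ! n ℚ.+ t

offset-beyond : ∀ x t {n} → supportBound x ℕ.≤ n → offset x t n ≡ t
offset-beyond x t n≥ = trans (cong (ℚ._+ t) (!-beyond x n≥)) (ℚP.+-identityˡ t)

offset-cancel : ∀ x y t n → offset x t n ≡ offset y t n → x ! n ≡ y ! n
offset-cancel x y t n = ∙-cancelʳ t (x ! n) (y ! n)

offset-+ : ∀ x y s t n → offset (x +ₛ y) (s ℚ.+ t) n ≡ offset x s n ℚ.+ offset y t n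
offset-+ x y s t n = trans (cong (ℚ._+ (s ℚ.+ t)) (+ₛ-! x y n)) (interchange (x ! n) (y ! n) s t)

offset-- : ∀ x t n → offset (-ₛ x) (ℚ.- t) n ≡ ℚ.- offset x t n
offset-- x t n = trans (cong (ℚ._+ ℚ.- t) (-ₛ-! x n)) (sym (ℚP.neg-distrib-+ (x ! n) t))

offset-* : ∀ c x t n → offset (c *ₛ x) (c ℚ.* t) n ≡ c ℚ.* offset x t n
offset-* c x t n = trans (cong (ℚ._+ c ℚ.* t) (*ₛ-! c x n)) (sym (ℚP.*-distribˡ-+ c (x ! n) t))

record ZBlock : Set where
  constructor zblock
  field
    neg pos : FinSupp
open ZBlock

zcoord : ℚ → ℚ → ZBlock → ℤ → ℚ
zcoord l r b -[1+ m ] = offset (neg b) l m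
zcoord l r b (+ m) = offset (pos b) r m

0ᴮ : ZBlock
0ᴮ = zblock 0ₛ 0ₛ

_+ᴮ_ : ZBlock → ZBlock → ZBlock
b +ᴮ b' = zblock (neg b +ₛ neg b') (pos b +ₛ pos b')

-ᴮ_ : ZBlock → ZBlock
-ᴮ b = zblock (-ₛ neg b) (-ₛ pos b)

_*ᴮ_ : ℚ → ZBlock → ZBlock
c *ᴮ b = zblock (c *ₛ neg b) (c *ₛ pos b)

zcoord-0ᴮ : ∀ l j → zcoord l l 0ᴮ j ≡ l
zcoord-0ᴮ l -[1+ m ] = ℚP.+-identityˡ l
zcoord-0ᴮ l (+ m) = ℚP.+-identityˡ l

zcoord-+ : ∀ l r l' r' b b' j → zcoord (l ℚ.+ l') (r ℚ.+ r') (b +ᴮ b') j ≡ zcoord l r b j ℚ.+ zcoord l' r' b' j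
zcoord-+ l r l' r' b b' -[1+ m ] = offset-+ (neg b) (neg b') l l' m
zcoord-+ l r l' r' b b' (+ m) = offset-+ (pos b) (pos b') r r' m

zcoord-- : ∀ l r b j → zcoord (ℚ.- l) (ℚ.- r) (-ᴮ b) j ≡ ℚ.- zcoord l r b j
zcoord-- l r b -[1+ m ] = offset-- (neg b) l m
zcoord-- l r b (+ m) = offset-- (pos b) r m

zcoord-* : ∀ c l r b j → zcoord (c ℚ.* l) (c ℚ.* r) (c *ᴮ b) j ≡ c ℚ.* zcoord l r b j
zcoord-* c l r b -[1+ m ] = offset-* c (neg b) l m
zcoord-* c l r b (+ m) = offset-* c (pos b) r m

zcoord-left : ∀ l r b {m} → supportBound (neg b) ℕ.≤ m → zcoord l r b -[1+ m ] ≡ l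
zcoord-left l r b = offset-beyond (neg b) l

zcoord-right : ∀ l r b {m} → supportBound (pos b) ℕ.≤ m → zcoord l r b (+ m) ≡ r
zcoord-right l r b = offset-beyond (pos b) r

zcoord-left-unique : ∀ {l r l' r' b b'} → (∀ j → zcoord l r b j ≡ zcoord l' r' b' j) → l ≡ l'
zcoord-left-unique {l} {r} {l'} {r'} {b} {b'} same =
  trans (sym (zcoord-left l r b (ℕP.m≤m+n _ _))) (trans (same -[1+ N ]) (zcoord-left l' r' b' (ℕP.m≤n+m _ _)))
  where
  N : ℕ
  N = supportBound (neg b) ℕ.+ supportBound (neg b')

zcoord-injective : ∀ {l r b b'} → (∀ j → zcoord l r b j ≡ zcoord l r b' j) → b ≡ b'
zcoord-injective {l} {r} {b} {b'} same = cong₂ zblock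
  (FinSupp-ext (λ m → offset-cancel (neg b) (neg b') l m (same -[1+ m ])))
  (FinSupp-ext (λ m → offset-cancel (pos b) (pos b') r m (same (+ m))))

-- coord x is the step function on I encoded by x: it takes the value ℓ₀ near the gap between ω and the
-- first copy of ℤ, the value ℓ₁ near the gap between the two copies, and vanishes at the top of I; the
-- FinSupp fields record the finitely many deviations from these values on ω and on both halves of each copy.
record G : Set where
  constructor mkG
  field
    ℓ₀ ℓ₁ : ℚ
    ω : FinSupp
    blk₀ blk₁ : ZBlock
open G

coord : G → I → ℚ
coord x (nat n) = offset (ω x) (ℓ₀ x) n
coord x (z₀ j) = zcoord (ℓ₀ x) (ℓ₁ x) (blk₀ x) j
coord x (z₁ j) = zcoord (ℓ₁ x) 0ℚ (blk₁ x) j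

0G : G
0G = mkG 0ℚ 0ℚ 0ₛ 0ᴮ 0ᴮ

infixl 6 _+G_
_+G_ : G → G → G
x +G y = mkG (ℓ₀ x ℚ.+ ℓ₀ y) (ℓ₁ x ℚ.+ ℓ₁ y) (ω x +ₛ ω y) (blk₀ x +ᴮ blk₀ y) (blk₁ x +ᴮ blk₁ y)

-G_ : G → G
-G x = mkG (ℚ.- ℓ₀ x) (ℚ.- ℓ₁ x) (-ₛ ω x) (-ᴮ blk₀ x) (-ᴮ blk₁ x)

_*G_ : ℚ → G → G
c *G x = mkG (c ℚ.* ℓ₀ x) (c ℚ.* ℓ₁ x) (c *ₛ ω x) (c *ᴮ blk₀ x) (c *ᴮ blk₁ x)

coord-0 : ∀ i → coord 0G i ≡ 0ℚ
coord-0 (nat n) = refl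
coord-0 (z₀ j) = zcoord-0ᴮ 0ℚ j
coord-0 (z₁ j) = zcoord-0ᴮ 0ℚ j

coord-+ : ∀ x y i → coord (x +G y) i ≡ coord x i ℚ.+ coord y i
coord-+ x y (nat n) = offset-+ (ω x) (ω y) (ℓ₀ x) (ℓ₀ y) n
coord-+ x y (z₀ j) = zcoord-+ (ℓ₀ x) (ℓ₁ x) (ℓ₀ y) (ℓ₁ y) (blk₀ x) (blk₀ y) j
coord-+ x y (z₁ j) = zcoord-+ (ℓ₁ x) 0ℚ (ℓ₁ y) 0ℚ (blk₁ x) (blk₁ y) j

coord-- : ∀ x i → coord (-G x) i ≡ ℚ.- coord x i
coord-- x (nat n) = offset-- (ω x) (ℓ₀ x) n
coord-- x (z₀ j) = zcoord-- (ℓ₀ x) (ℓ₁ x) (blk₀ x) j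
coord-- x (z₁ j) = zcoord-- (ℓ₁ x) 0ℚ (blk₁ x) j

coord-* : ∀ c x i → coord (c *G x) i ≡ c ℚ.* coord x i
coord-* c x (nat n) = offset-* c (ω x) (ℓ₀ x) n
coord-* c x (z₀ j) = zcoord-* c (ℓ₀ x) (ℓ₁ x) (blk₀ x) j
coord-* c x (z₁ j) = trans (cong (λ r → zcoord (c ℚ.* ℓ₁ x) r (c *ᴮ blk₁ x) j) (sym (ℚP.*-zeroʳ c)))
                           (zcoord-* c (ℓ₁ x) 0ℚ (blk₁ x) j)

coord-injective : ∀ {x y} → (∀ i → coord x i ≡ coord y i) → x ≡ y
coord-injective {mkG ℓ₀ ℓ₁ ω b₀ b₁} {mkG ℓ₀' ℓ₁' ω' b₀' b₁'} same
  with refl ← zcoord-left-unique (same ∘ z₁) | refl ← zcoord-left-unique (same ∘ z₀)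
  = cong₃ (FinSupp-ext (λ n → offset-cancel ω ω' ℓ₀ n (same (nat n))))
          (zcoord-injective (same ∘ z₀)) (zcoord-injective (same ∘ z₁))
  where
  cong₃ : ∀ {ω ω' b₀ b₀' b₁ b₁'} → ω ≡ ω' → b₀ ≡ b₀' → b₁ ≡ b₁' →
          mkG ℓ₀ ℓ₁ ω b₀ b₁ ≡ mkG ℓ₀ ℓ₁ ω' b₀' b₁'
  cong₃ refl refl refl = refl

stepᴮ : ℤ → ZBlock
stepᴮ (+ m) = zblock 0ₛ (replicateₛ (suc m) 1ℚ)
stepᴮ -[1+ m ] = zblock (replicateₛ m (ℚ.- 1ℚ)) 0ₛ

zcoord-step-≤ : ∀ {j k} → k ℤ.≤ j → zcoord 1ℚ 0ℚ (stepᴮ j) k ≡ 1ℚ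
zcoord-step-≤ (+≤+ k≤m) = cong (ℚ._+ 0ℚ) (replicateₛ-!-< 1ℚ (s≤s k≤m))
zcoord-step-≤ -≤+ = refl
zcoord-step-≤ (-≤- m≤k) = cong (ℚ._+ 1ℚ) (replicateₛ-!-≥ (ℚ.- 1ℚ) m≤k)

zcoord-step-> : ∀ {j k} → j ℤ.< k → zcoord 1ℚ 0ℚ (stepᴮ j) k ≡ 0ℚ
zcoord-step-> (+<+ m<k) = cong (ℚ._+ 0ℚ) (replicateₛ-!-≥ 1ℚ m<k)
zcoord-step-> -<+ = refl
zcoord-step-> (-<- k<m) = cong (ℚ._+ 1ℚ) (replicateₛ-!-< (ℚ.- 1ℚ) k<m)

-- ψe i is the indicator function of the initial segment of I up to i
ψe : I → G
ψe (nat n) = mkG 0ℚ 0ℚ (replicateₛ (suc n) 1ℚ) 0ᴮ 0ᴮ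
ψe (z₀ j) = mkG 1ℚ 0ℚ 0ₛ (stepᴮ j) 0ᴮ
ψe (z₁ j) = mkG 1ℚ 1ℚ 0ₛ 0ᴮ (stepᴮ j)

≤I-ℤ₀ : ∀ {j k} → z₀ k ≤I z₀ j → k ℤ.≤ j
≤I-ℤ₀ (inj₁ (₂∼₂ (₁∼₁ k<j))) = ℤP.<⇒≤ k<j
≤I-ℤ₀ (inj₂ refl) = ℤP.≤-refl

≤I-ℤ₁ : ∀ {j k} → z₁ k ≤I z₁ j → k ℤ.≤ j
≤I-ℤ₁ (inj₁ (₂∼₂ (₂∼₂ k<j))) = ℤP.<⇒≤ k<j
≤I-ℤ₁ (inj₂ refl) = ℤP.≤-refl

≤I-ℕ : ∀ {m n} → nat m ≤I nat n → m ℕ.< suc n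
≤I-ℕ (inj₁ (₁∼₁ m<n)) = ℕP.m<n⇒m<1+n m<n
≤I-ℕ (inj₂ refl) = ℕP.n<1+n _

coord-ψe-≤ : ∀ {i k} → k ≤I i → coord (ψe i) k ≡ 1ℚ
coord-ψe-≤ {nat n} {nat m} k≤i = cong (ℚ._+ 0ℚ) (replicateₛ-!-< 1ℚ (≤I-ℕ k≤i))
coord-ψe-≤ {z₀ j} {nat m} _ = refl
coord-ψe-≤ {z₀ j} {z₀ k} k≤i = zcoord-step-≤ (≤I-ℤ₀ k≤i)
coord-ψe-≤ {z₁ j} {nat m} _ = refl
coord-ψe-≤ {z₁ j} {z₀ k} _ = zcoord-0ᴮ 1ℚ k
coord-ψe-≤ {z₁ j} {z₁ k} k≤i = zcoord-step-≤ (≤I-ℤ₁ k≤i)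
coord-ψe-≤ {nat n} {z₀ k} (inj₁ ())
coord-ψe-≤ {nat n} {z₁ k} (inj₁ ())
coord-ψe-≤ {z₀ j} {z₁ k} (inj₁ (₂∼₂ ()))

coord-ψe-> : ∀ {i k} → i <I k → coord (ψe i) k ≡ 0ℚ
coord-ψe-> {nat n} {nat m} (₁∼₁ n<m) = cong (ℚ._+ 0ℚ) (replicateₛ-!-≥ 1ℚ n<m)
coord-ψe-> {nat n} {z₀ k} _ = zcoord-0ᴮ 0ℚ k
coord-ψe-> {nat n} {z₁ k} _ = zcoord-0ᴮ 0ℚ k
coord-ψe-> {z₀ j} {z₀ k} (₂∼₂ (₁∼₁ j<k)) = zcoord-step-> j<k
coord-ψe-> {z₀ j} {z₁ k} _ = zcoord-0ᴮ 0ℚ k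
coord-ψe-> {z₁ j} {z₁ k} (₂∼₂ (₂∼₂ j<k)) = zcoord-step-> j<k

+G-assoc : ∀ x y z → (x +G y) +G z ≡ x +G (y +G z)
+G-assoc x y z = coord-injective λ i → begin
  coord ((x +G y) +G z) i                 ≡⟨ coord-+ (x +G y) z i ⟩
  coord (x +G y) i ℚ.+ coord z i          ≡⟨ cong (ℚ._+ coord z i) (coord-+ x y i) ⟩
  (coord x i ℚ.+ coord y i) ℚ.+ coord z i ≡⟨ ℚP.+-assoc (coord x i) (coord y i) (coord z i) ⟩
  coord x i ℚ.+ (coord y i ℚ.+ coord z i) ≡⟨ cong (coord x i ℚ.+_) (coord-+ y z i) ⟨
  coord x i ℚ.+ coord (y +G z) i          ≡⟨ coord-+ x (y +G z) i ⟨
  coord (x +G (y +G z)) i                 ∎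
  where open ≡-Reasoning

+G-comm : ∀ x y → x +G y ≡ y +G x
+G-comm x y = coord-injective λ i →
  trans (coord-+ x y i) (trans (ℚP.+-comm (coord x i) (coord y i)) (sym (coord-+ y x i)))

+G-identityˡ : ∀ x → 0G +G x ≡ x
+G-identityˡ x = coord-injective λ i →
  trans (coord-+ 0G x i) (trans (cong (ℚ._+ coord x i) (coord-0 i)) (ℚP.+-identityˡ (coord x i)))

+G-inverseˡ : ∀ x → (-G x) +G x ≡ 0G
+G-inverseˡ x = coord-injective λ i →
  trans (coord-+ (-G x) x i) (trans (cong (ℚ._+ coord x i) (coord-- x i))
        (trans (ℚP.+-inverseˡ (coord x i)) (sym (coord-0 i))))

coord-difference : ∀ x y i → coord (y +G -G x) i ≡ coord y i ℚ.+ ℚ.- coord x i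
coord-difference x y i = trans (coord-+ y (-G x) i) (cong (coord y i ℚ.+_) (coord-- x i))

difference-zero : ∀ x y i → coord (y +G -G x) i ≡ 0ℚ → coord x i ≡ coord y i
difference-zero x y i d≡0 = sym (trans (sym (//-rightDividesˡ (coord x i) (coord y i)))
  (trans (cong (ℚ._+ coord x i) (trans (sym (coord-difference x y i)) d≡0)) (ℚP.+-identityˡ (coord x i))))

FirstDev : G → ℚ → I → Set
FirstDev x c = FirstDeviation _<I_ (coord x) c

-- opaque: only its type is used below, and unfolding the search inside goals makes checking very slow
opaque
  deviation : ∀ x c → Deviation _<I_ (coord x) c
  deviation x c = deviation-⊎ on-ω λ ω-const → deviation-⊎ (on-ℤ₀ ω-const) λ ℤ₀-const → on-ℤ₁ ℤ₀-const
    where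
    bound : ZBlock → ℕ
    bound b = supportBound (neg b) ℕ.+ supportBound (pos b)
    left : ∀ l r b → l ≡ c → ∀ m → bound b ℕ.≤ m → zcoord l r b -[1+ m ] ≡ c
    left l r b l≡c m N≤m = trans (zcoord-left l r b (ℕP.≤-trans (ℕP.m≤m+n _ _) N≤m)) l≡c
    right : ∀ l r b → ∀ k → bound b ℕ.≤ k → zcoord l r b (+ k) ≡ r
    right l r b k N≤k = zcoord-right l r b (ℕP.≤-trans (ℕP.m≤n+m _ _) N≤k)
    on-ω : Deviation ℕ._<_ (λ n → coord x (nat n)) c
    on-ω = deviation-ℕ ℚ._≟_ (supportBound (ω x)) (ℓ₀ x) (λ k → offset-beyond (ω x) (ℓ₀ x))
    on-ℤ₀ : (∀ n → coord x (nat n) ≡ c) → Deviation ℤ._<_ (λ j → coord x (z₀ j)) c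
    on-ℤ₀ ω-const = deviation-ℤ ℚ._≟_ (bound (blk₀ x)) (ℓ₁ x)
      (left (ℓ₀ x) (ℓ₁ x) (blk₀ x) (trans (sym (offset-beyond (ω x) (ℓ₀ x) ℕP.≤-refl)) (ω-const (supportBound (ω x)))))
      (right (ℓ₀ x) (ℓ₁ x) (blk₀ x))
    on-ℤ₁ : (∀ j → coord x (z₀ j) ≡ c) → Deviation ℤ._<_ (λ j → coord x (z₁ j)) c
    on-ℤ₁ ℤ₀-const = deviation-ℤ ℚ._≟_ (bound (blk₁ x)) 0ℚ
      (left (ℓ₁ x) 0ℚ (blk₁ x) (trans (sym (zcoord-right (ℓ₀ x) (ℓ₁ x) (blk₀ x) ℕP.≤-refl))
                                      (ℤ₀-const (+ supportBound (pos (blk₀ x))))))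
      (right (ℓ₁ x) 0ℚ (blk₁ x))

_≟G_ : DecidableEquality G
x ≟G y with deviation (y +G -G x) 0ℚ
... | inj₁ (i , _ , differs) = no λ { refl → differs (trans (coord-difference x x i) (ℚP.+-inverseʳ (coord x i))) }
... | inj₂ same = yes (coord-injective (λ i → difference-zero x y i (same i)))

infix 4 _<G_ _≤G_

_<G_ : G → G → Set
x <G y = Σ I λ i → (∀ k → k <I i → coord x k ≡ coord y k) × coord x i ℚ.< coord y i

_≤G_ : G → G → Set
x ≤G y = x <G y ⊎ x ≡ y

<G-irrefl : ∀ x → ¬ x <G x
<G-irrefl x (i , _ , x<x) = ℚP.<-irrefl refl x<x

<G-trans : ∀ x y z → x <G y → y <G z → x <G z
<G-trans x y z (i , below-i , x<y) (j , below-j , y<z) with <I-compare i j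
... | tri< i<j _ _ = i , (λ k k<i → trans (below-i k k<i) (below-j k (<I-trans k<i i<j))) , ℚP.<-respʳ-≡ (below-j i i<j) x<y
... | tri≈ _ refl _ = i , (λ k k<i → trans (below-i k k<i) (below-j k k<i)) , ℚP.<-trans x<y y<z
... | tri> _ _ j<i = j , (λ k k<j → trans (below-i k (<I-trans k<j j<i)) (below-j k k<j)) , ℚP.<-respˡ-≡ (sym (below-i j j<i)) y<z

<G-asym : ∀ x y → x <G y → ¬ y <G x
<G-asym x y x<y y<x = <G-irrefl x (<G-trans x y x x<y y<x)

<G-trichotomy : ∀ x y → x <G y ⊎ x ≡ y ⊎ y <G x
<G-trichotomy x y with deviation (y +G -G x) 0ℚ
... | inj₂ same = inj₂ (inj₁ (coord-injective (λ k → difference-zero x y k (same k))))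
... | inj₁ (i , below , differs) with ℚP.<-cmp (coord x i) (coord y i)
...   | tri< x<y _ _ = inj₁ (i , (λ k k<i → difference-zero x y k (below k k<i)) , x<y)
...   | tri≈ _ x≡y _ = ⊥-elim (differs (trans (coord-difference x y i)
                         (trans (cong (ℚ._+ ℚ.- coord x i) (sym x≡y)) (ℚP.+-inverseʳ (coord x i)))))
...   | tri> _ _ y<x = inj₂ (inj₂ (i , (λ k k<i → sym (difference-zero x y k (below k k<i))) , y<x))

<G-+ : ∀ x y z → x <G y → x +G z <G y +G z
<G-+ x y z (i , below , x<y) =
  i , (λ k k<i → trans (coord-+ x z k) (trans (cong (ℚ._+ coord z k) (below k k<i)) (sym (coord-+ y z k)))) ,
  subst₂ ℚ._<_ (sym (coord-+ x z i)) (sym (coord-+ y z i)) (ℚP.+-monoˡ-< (coord z i) x<y)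

ψe-mono : ∀ {i j} → i <I j → ψe i <G ψe j
ψe-mono {i} {j} i<j =
  sucI i , agree , subst₂ ℚ._<_ (sym (coord-ψe-> (<sucI i))) (sym (coord-ψe-≤ (sucI-least i<j))) (ℚP.positive⁻¹ 1ℚ)
  where
  agree : ∀ k → k <I sucI i → coord (ψe i) k ≡ coord (ψe j) k
  agree k k<1+i = trans (coord-ψe-≤ (<sucI⇒≤ k<1+i)) (sym (coord-ψe-≤ (inj₁ (≤<I-trans (<sucI⇒≤ k<1+i) i<j))))

ψe-mono-≤ : ∀ {i j} → i ≤I j → ψe i ≤G ψe j
ψe-mono-≤ (inj₁ i<j) = inj₁ (ψe-mono i<j)
ψe-mono-≤ (inj₂ refl) = inj₂ refl

ψe-reflects-< : ∀ {i j} → ψe i <G ψe j → i <I j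
ψe-reflects-< {i} {j} ψi<ψj with <I-compare i j
... | tri< i<j _ _ = i<j
... | tri≈ _ refl _ = ⊥-elim (<G-irrefl _ ψi<ψj)
... | tri> _ _ j<i = ⊥-elim (<G-asym _ _ ψi<ψj (ψe-mono j<i))

ψe-injective : ∀ {i j} → ψe i ≡ ψe j → i ≡ j
ψe-injective {i} {j} ψi≡ψj with <I-compare i j
... | tri< i<j _ _ = ⊥-elim (<G-irrefl _ (subst (_<G ψe j) ψi≡ψj (ψe-mono i<j)))
... | tri≈ _ i≡j _ = i≡j
... | tri> _ _ j<i = ⊥-elim (<G-irrefl _ (subst (ψe j <G_) ψi≡ψj (ψe-mono j<i)))

ψG : G → Maybe G
ψG x with deviation x 0ℚ
... | inj₁ (i , _) = just (ψe i)
... | inj₂ _ = nothing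

ψG-spec : ∀ {x i} → FirstDev x 0ℚ i → ψG x ≡ just (ψe i)
ψG-spec {x} {i} first with deviation x 0ℚ
... | inj₁ (j , first′) = cong (just ∘ ψe) (FirstDeviation-unique <I-compare first′ first)
... | inj₂ vanishes = ⊥-elim (proj₂ first (vanishes i))

ψG-0 : ψG 0G ≡ nothing
ψG-0 with deviation 0G 0ℚ
... | inj₁ (j , _ , nonzero) = ⊥-elim (nonzero (coord-0 j))
... | inj₂ _ = refl

ψG-just : ∀ {x y} → ψG x ≡ just y → Σ I λ i → FirstDev x 0ℚ i × ψe i ≡ y
ψG-just {x} eq with deviation x 0ℚ
... | inj₁ (i , first) = i , first , just-injective eq

nonzero-lead : ∀ {x} → x ≢ 0G → Σ I (FirstDev x 0ℚ)
nonzero-lead {x} x≢0 with deviation x 0ℚ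
... | inj₁ found = found
... | inj₂ vanishes = ⊥-elim (x≢0 (coord-injective (λ k → trans (vanishes k) (sym (coord-0 k)))))

lead-nonzero : ∀ {x i} → FirstDev x 0ℚ i → x ≢ 0G
lead-nonzero {i = i} (_ , nonzero) refl = nonzero (coord-0 i)

positive-lead : ∀ {x} → 0G <G x → Σ I λ i → FirstDev x 0ℚ i × 0ℚ ℚ.< coord x i
positive-lead {x} (i , below , 0<x) =
  i , ((λ k k<i → trans (sym (below k k<i)) (coord-0 k)) , (λ x≡0 → ℚP.<-irrefl (sym x≡0) 0<xi)) , 0<xi
  where
  0<xi : 0ℚ ℚ.< coord x i
  0<xi = ℚP.<-respˡ-≡ (coord-0 i) 0<x

first-non-one : ∀ γ → Σ I (FirstDev γ 1ℚ)
first-non-one γ with deviation γ 1ℚ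
... | inj₁ found = found
... | inj₂ one =
  ⊥-elim (ℚP.<-irrefl (trans (sym (zcoord-right (ℓ₁ γ) 0ℚ (blk₁ γ) ℕP.≤-refl)) (one (z₁ (+ N)))) (ℚP.positive⁻¹ 1ℚ))
  where
  N : ℕ
  N = supportBound (pos (blk₁ γ))

s-index : G → I
s-index γ = proj₁ (first-non-one γ)

sG : G → G
sG γ = ψe (s-index γ)

s-index-spec : ∀ {γ i} → FirstDev γ 1ℚ i → s-index γ ≡ i
s-index-spec {γ} = FirstDeviation-unique <I-compare (proj₂ (first-non-one γ))

ψe-first-non-one : ∀ i → FirstDev (ψe i) 1ℚ (sucI i)
ψe-first-non-one i = (λ k k<1+i → coord-ψe-≤ (<sucI⇒≤ k<1+i)) ,
                     (λ one → ℚP.<-irrefl (trans (sym (coord-ψe-> (<sucI i))) one) (ℚP.positive⁻¹ 1ℚ))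

s-index-ψe : ∀ i → s-index (ψe i) ≡ sucI i
s-index-ψe i = s-index-spec (ψe-first-non-one i)

sG-ψe : ∀ i → sG (ψe i) ≡ ψe (sucI i)
sG-ψe i = cong ψe (s-index-ψe i)

sG-0 : sG 0G ≡ ψe (nat 0)
sG-0 = cong ψe (s-index-spec {0G} {nat 0} ((λ { _ (₁∼₁ ()) }) , (λ ())))

accept : ∀ {y m} → Dec (y ≡ ψe m) → Maybe I
accept {m = m} (yes _) = just m
accept (no _) = nothing

accept-just : ∀ {y m m′} (d : Dec (y ≡ ψe m)) → accept d ≡ just m′ → y ≡ ψe m′
accept-just (yes y≡ψm) refl = y≡ψm

accept-yes : ∀ {y m} (d : Dec (y ≡ ψe m)) → y ≡ ψe m → accept d ≡ just m
accept-yes (yes _) _ = refl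
accept-yes (no y≢ψm) y≡ψm = ⊥-elim (y≢ψm y≡ψm)

Ψ-index-from : G → Maybe I → Maybe I
Ψ-index-from y nothing = nothing
Ψ-index-from y (just m) = accept (y ≟G ψe m)

-- ψe m has s-index sucI m, so y can only be ψe m for the predecessor m of s-index y
Ψ-index : G → Maybe I
Ψ-index y = Ψ-index-from y (pred? (s-index y))

Ψ-index-just : ∀ {y m} → Ψ-index y ≡ just m → y ≡ ψe m
Ψ-index-just {y} = from (pred? (s-index y))
  where
  from : ∀ {m} mb → Ψ-index-from y mb ≡ just m → y ≡ ψe m
  from (just m) = accept-just (y ≟G ψe m)

Ψ-index-ψe : ∀ m → Ψ-index (ψe m) ≡ just m
Ψ-index-ψe m = begin
  Ψ-index-from (ψe m) (pred? (s-index (ψe m))) ≡⟨ cong (Ψ-index-from (ψe m) ∘ pred?) (s-index-ψe m) ⟩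
  Ψ-index-from (ψe m) (pred? (sucI m))         ≡⟨ cong (Ψ-index-from (ψe m)) (pred?-sucI m) ⟩
  accept (ψe m ≟G ψe m)                        ≡⟨ accept-yes (ψe m ≟G ψe m) refl ⟩
  just m                                       ∎
  where open ≡-Reasoning

pG : G → Maybe G
pG y = Maybe.map ψe (Ψ-index y Maybe.>>= pred?)

pG-ψe-sucI : ∀ i → pG (ψe (sucI i)) ≡ just (ψe i)
pG-ψe-sucI i = begin
  Maybe.map ψe (Ψ-index (ψe (sucI i)) Maybe.>>= pred?) ≡⟨ cong (λ mb → Maybe.map ψe (mb Maybe.>>= pred?)) (Ψ-index-ψe (sucI i)) ⟩
  Maybe.map ψe (pred? (sucI i))                        ≡⟨ cong (Maybe.map ψe) (pred?-sucI i) ⟩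
  just (ψe i)                                          ∎
  where open ≡-Reasoning

pG-just : ∀ {y z} → pG y ≡ just z → Σ I λ i → y ≡ ψe (sucI i) × z ≡ ψe i
pG-just {y} = from (Ψ-index y) refl
  where
  from : ∀ {z} mb → Ψ-index y ≡ mb → Maybe.map ψe (mb Maybe.>>= pred?) ≡ just z → Σ I λ i → y ≡ ψe (sucI i) × z ≡ ψe i
  from (just m) index≡m eq with pred? m in pred≡
  from (just m) index≡m refl | just i = i , trans (Ψ-index-just index≡m) (cong ψe (sym (pred?-just pred≡))) , refl

-- The model of T_log

+G-cancelʳ : ∀ β x γ → β +G x ≡ γ → β ≡ γ +G -G x
+G-cancelʳ β x γ β+x≡γ = coord-injective λ k → begin
  coord β k                                  ≡⟨ //-rightDividesʳ (coord x k) (coord β k) ⟨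
  (coord β k ℚ.+ coord x k) ℚ.+ ℚ.- coord x k ≡⟨ cong (ℚ._+ ℚ.- coord x k) (sym (coord-+ β x k)) ⟩
  coord (β +G x) k ℚ.+ ℚ.- coord x k          ≡⟨ cong (λ z → coord z k ℚ.+ ℚ.- coord x k) β+x≡γ ⟩
  coord γ k ℚ.+ ℚ.- coord x k                 ≡⟨ coord-difference x γ k ⟨
  coord (γ +G -G x) k                        ∎
  where open ≡-Reasoning

-G+G : ∀ γ x → (γ +G -G x) +G x ≡ γ
-G+G γ x = coord-injective λ k →
  trans (coord-+ (γ +G -G x) x k) (trans (cong (ℚ._+ coord x k) (coord-difference x γ k)) (//-rightDividesˡ (coord x k) (coord γ k)))

0<1 : 0ℚ ℚ.< 1ℚ
0<1 = ℚP.positive⁻¹ 1ℚ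

×ℚ1-nonneg : ∀ n → 0ℚ ℚ.≤ n ×ℚ 1ℚ
×ℚ1-nonneg zero = ℚP.≤-refl
×ℚ1-nonneg (suc n) = ℚP.+-mono-≤ (ℚP.<⇒≤ 0<1) (×ℚ1-nonneg n)

suc×ℚ1-pos : ∀ n → 0ℚ ℚ.< suc n ×ℚ 1ℚ
suc×ℚ1-pos n = ℚP.+-mono-<-≤ 0<1 (×ℚ1-nonneg n)

×ℚ-as-* : ∀ n a → n ×ℚ a ≡ (n ×ℚ 1ℚ) ℚ.* a
×ℚ-as-* n a = sym (trans (×-assoc-* n 1ℚ a) (cong (n ×ℚ_) (ℚP.*-identityˡ a)))

*-cancel-nonzero : ∀ {c a} → c ≢ 0ℚ → c ℚ.* a ≡ 0ℚ → a ≡ 0ℚ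
*-cancel-nonzero {c} {a} c≢0 ca≡0 = begin
  a                  ≡⟨ ℚP.*-identityˡ a ⟨
  1ℚ ℚ.* a           ≡⟨ cong (ℚ._* a) (ℚP.*-inverseˡ c) ⟨
  (c⁻¹ ℚ.* c) ℚ.* a  ≡⟨ ℚP.*-assoc c⁻¹ c a ⟩
  c⁻¹ ℚ.* (c ℚ.* a)  ≡⟨ cong (c⁻¹ ℚ.*_) ca≡0 ⟩
  c⁻¹ ℚ.* 0ℚ         ≡⟨ ℚP.*-zeroʳ c⁻¹ ⟩
  0ℚ                 ∎
  where
  open ≡-Reasoning
  instance
    c-nonzero : ℚ.NonZero c
    c-nonzero = ℚ.≢-nonZero c≢0
  c⁻¹ : ℚ
  c⁻¹ = ℚ.1/ c

suc×ℚ≡0 : ∀ n {a} → suc n ×ℚ a ≡ 0ℚ → a ≡ 0ℚ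
suc×ℚ≡0 n {a} na≡0 =
  *-cancel-nonzero (λ n≡0 → ℚP.<-irrefl (sym n≡0) (suc×ℚ1-pos n)) (trans (sym (×ℚ-as-* (suc n) a)) na≡0)

×ℚ-0 : ∀ n → n ×ℚ 0ℚ ≡ 0ℚ
×ℚ-0 n = trans (×ℚ-as-* n 0ℚ) (ℚP.*-zeroʳ (n ×ℚ 1ℚ))

1/suc : ℕ → ℚ
1/suc n = ℚ.1/ (suc n ×ℚ 1ℚ)
  where
  instance
    n+1-nonzero : ℚ.NonZero (suc n ×ℚ 1ℚ)
    n+1-nonzero = ℚ.>-nonZero (suc×ℚ1-pos n)

δG : ℕ → G → G
δG n x = 1/suc n *G x

Γlog-raw : LlogRaw
Γlog-raw = record
  { Γ = G ; 0g = 0G ; _+_ = _+G_ ; -_ = -G_ ; _<_ = _<G_ ; ψ = ψG ; s = sG ; p = pG ; δ = δG }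

open RawDefs Γlog-raw using (natMul; zMul; IsInt; InΨ; _≤∞_)

coord-natMul : ∀ n x k → coord (natMul n x) k ≡ n ×ℚ coord x k
coord-natMul zero x k = coord-0 k
coord-natMul (suc n) x k = trans (coord-+ x (natMul n x) k) (cong (coord x k ℚ.+_) (coord-natMul n x k))

δG-divides : ∀ n x → natMul (suc n) (δG n x) ≡ x
δG-divides n x = coord-injective λ k → begin
  coord (natMul (suc n) (δG n x)) k  ≡⟨ coord-natMul (suc n) (δG n x) k ⟩
  suc n ×ℚ coord (δG n x) k          ≡⟨ ×ℚ-as-* (suc n) _ ⟩
  N ℚ.* coord (δG n x) k             ≡⟨ cong (N ℚ.*_) (coord-* (ℚ.1/ N) x k) ⟩
  N ℚ.* (ℚ.1/ N ℚ.* coord x k)       ≡⟨ ℚP.*-assoc N (ℚ.1/ N) (coord x k) ⟨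
  (N ℚ.* ℚ.1/ N) ℚ.* coord x k       ≡⟨ cong (ℚ._* coord x k) (ℚP.*-inverseʳ N) ⟩
  1ℚ ℚ.* coord x k                   ≡⟨ ℚP.*-identityˡ (coord x k) ⟩
  coord x k                          ∎
  where
  open ≡-Reasoning
  N : ℚ
  N = suc n ×ℚ 1ℚ
  instance
    N-nonzero : ℚ.NonZero N
    N-nonzero = ℚ.>-nonZero (suc×ℚ1-pos n)

ψG-≤∞ : ∀ {x y i j} → FirstDev x 0ℚ i → FirstDev y 0ℚ j → i ≤I j → ψG x ≤∞ ψG y
ψG-≤∞ lead-x lead-y i≤j rewrite ψG-spec lead-x | ψG-spec lead-y = ψe-mono-≤ i≤j

lead-of-sum : ∀ {α β i j l} → FirstDev α 0ℚ i → FirstDev β 0ℚ j → FirstDev (α +G β) 0ℚ l → ¬ (l <I i × l <I j)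
lead-of-sum {α} {β} {l = l} (below-α , _) (below-β , _) (_ , nonzero) (l<i , l<j) =
  nonzero (trans (coord-+ α β l) (cong₂ ℚ._+_ (below-α l l<i) (below-β l l<j)))

ψG-AC1 : ∀ α β → α ≢ 0G → β ≢ 0G → α +G β ≢ 0G → (ψG α ≤∞ ψG (α +G β)) ⊎ (ψG β ≤∞ ψG (α +G β))
ψG-AC1 α β α≢0 β≢0 α+β≢0
  with i , lead-α ← nonzero-lead α≢0 | j , lead-β ← nonzero-lead β≢0 | l , lead-αβ ← nonzero-lead α+β≢0
  with <I-compare i j
... | tri< i<j _ _ = inj₁ (ψG-≤∞ lead-α lead-αβ (≮I⇒≥ λ l<i → lead-of-sum lead-α lead-β lead-αβ (l<i , <I-trans l<i i<j)))
... | tri≈ _ refl _ = inj₁ (ψG-≤∞ lead-α lead-αβ (≮I⇒≥ λ l<i → lead-of-sum lead-α lead-β lead-αβ (l<i , l<i)))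
... | tri> _ _ j<i = inj₂ (ψG-≤∞ lead-β lead-αβ (≮I⇒≥ λ l<j → lead-of-sum lead-α lead-β lead-αβ (<I-trans l<j j<i , l<j)))

coord-zMul≡0⇔ : ∀ r x k → r ≢ + 0 → coord (zMul r x) k ≡ 0ℚ ⇔ coord x k ≡ 0ℚ
coord-zMul≡0⇔ (+ zero) x k r≢0 = ⊥-elim (r≢0 refl)
coord-zMul≡0⇔ (+ suc n) x k _ = mk⇔
  (suc×ℚ≡0 n ∘ trans (sym (coord-natMul (suc n) x k)))
  (λ xk≡0 → trans (coord-natMul (suc n) x k) (trans (cong (suc n ×ℚ_) xk≡0) (×ℚ-0 (suc n))))
coord-zMul≡0⇔ -[1+ n ] x k _ = mk⇔
  (Equivalence.to (coord-zMul≡0⇔ (+ suc n) x k (λ ())) ∘ ℚP.neg-injective ∘ trans (sym (coord-- (natMul (suc n) x) k)))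
  (λ xk≡0 → trans (coord-- (natMul (suc n) x) k) (cong ℚ.-_ (Equivalence.from (coord-zMul≡0⇔ (+ suc n) x k (λ ())) xk≡0)))

ψG-AC2 : ∀ (r : ℤ) α → r ≢ + 0 → α ≢ 0G → ψG (zMul r α) ≡ ψG α
ψG-AC2 r α r≢0 α≢0 with i , (below , at-i) ← nonzero-lead α≢0 =
  trans (ψG-spec ((λ k k<i → Equivalence.from (zero⇔ k) (below k k<i)) , at-i ∘ Equivalence.to (zero⇔ i)))
        (sym (ψG-spec (below , at-i)))
  where
  zero⇔ : ∀ k → coord (zMul r α) k ≡ 0ℚ ⇔ coord α k ≡ 0ℚ
  zero⇔ k = coord-zMul≡0⇔ r α k r≢0

coord-α+ψe-below : ∀ {α i k} → FirstDev α 0ℚ i → k <I i → coord (α +G ψe i) k ≡ 1ℚ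
coord-α+ψe-below {α} {i} {k} (below , _) k<i =
  trans (coord-+ α (ψe i) k) (trans (cong₂ ℚ._+_ (below k k<i) (coord-ψe-≤ (inj₁ k<i))) (ℚP.+-identityˡ 1ℚ))

coord-α+ψe-at : ∀ α i → coord (α +G ψe i) i ≡ coord α i ℚ.+ 1ℚ
coord-α+ψe-at α i = trans (coord-+ α (ψe i) i) (cong (coord α i ℚ.+_) (coord-ψe-≤ {i} (inj₂ refl)))

1<a+1 : ∀ {a} → 0ℚ ℚ.< a → 1ℚ ℚ.< a ℚ.+ 1ℚ
1<a+1 {a} 0<a = subst (ℚ._< a ℚ.+ 1ℚ) (ℚP.+-identityˡ 1ℚ) (ℚP.+-monoˡ-< 1ℚ 0<a)

-- α + ψe i is 1 below i and exceeds 1 at i, while ψe m only takes the values 0 and 1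
ψe<α+ψe : ∀ {α i} m → FirstDev α 0ℚ i → 0ℚ ℚ.< coord α i → ψe m <G α +G ψe i
ψe<α+ψe {α} {i} m lead-α 0<αi with <I-compare m i
... | tri< m<i _ _ = sucI m , agree , subst₂ ℚ._<_ (sym (coord-ψe-> (<sucI m))) (sym (coord-+ α (ψe i) (sucI m))) 0<α+1
  where
  agree : ∀ k → k <I sucI m → coord (ψe m) k ≡ coord (α +G ψe i) k
  agree k k<1+m = trans (coord-ψe-≤ (<sucI⇒≤ k<1+m)) (sym (coord-α+ψe-below lead-α (≤<I-trans (<sucI⇒≤ k<1+m) m<i)))
  α≥0 : 0ℚ ℚ.≤ coord α (sucI m)
  α≥0 = [ (λ 1+m<i → ℚP.≤-reflexive (sym (proj₁ lead-α _ 1+m<i))) , (λ { refl → ℚP.<⇒≤ 0<αi }) ] (sucI-least m<i)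
  0<α+1 : 0ℚ ℚ.< coord α (sucI m) ℚ.+ coord (ψe i) (sucI m)
  0<α+1 = subst (λ z → 0ℚ ℚ.< coord α (sucI m) ℚ.+ z) (sym (coord-ψe-≤ (sucI-least m<i))) (ℚP.+-mono-≤-< α≥0 0<1)
... | tri≈ _ refl _ = i , agree , subst₂ ℚ._<_ (sym (coord-ψe-≤ {i} (inj₂ refl))) (sym (coord-α+ψe-at α i)) (1<a+1 0<αi)
  where
  agree : ∀ k → k <I i → coord (ψe i) k ≡ coord (α +G ψe i) k
  agree k k<i = trans (coord-ψe-≤ (inj₁ k<i)) (sym (coord-α+ψe-below lead-α k<i))
... | tri> _ _ i<m = i , agree , subst₂ ℚ._<_ (sym (coord-ψe-≤ (inj₁ i<m))) (sym (coord-α+ψe-at α i)) (1<a+1 0<αi)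
  where
  agree : ∀ k → k <I i → coord (ψe m) k ≡ coord (α +G ψe i) k
  agree k k<i = trans (coord-ψe-≤ (inj₁ (<I-trans k<i i<m))) (sym (coord-α+ψe-below lead-α k<i))

ψG-AC3 : ∀ α β a b → 0G <G α → β ≢ 0G → ψG α ≡ just a → ψG β ≡ just b → b <G α +G a
ψG-AC3 α β a b 0<α β≢0 ψα≡a ψβ≡b
  with i , lead-α , 0<αi ← positive-lead 0<α | i′ , lead-α′ , refl ← ψG-just ψα≡a | m , _ , refl ← ψG-just ψβ≡b
  with refl ← FirstDeviation-unique <I-compare lead-α lead-α′
  = ψe<α+ψe m lead-α 0<αi

ψG-Htype : ∀ α β → 0G <G α → α ≤G β → ψG β ≤∞ ψG α
ψG-Htype α β 0<α (inj₂ refl) with ψG α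
... | just _ = inj₂ refl
... | nothing = tt
ψG-Htype α β 0<α (inj₁ α<β)
  with i , lead-α , 0<αi ← positive-lead 0<α | j , lead-β , _ ← positive-lead (<G-trans _ _ _ 0<α α<β)
  = ψG-≤∞ lead-β lead-α (≮I⇒≥ (i≮j α<β))
  where
  i≮j : α <G β → ¬ i <I j
  i≮j (t , below , αt<βt) i<j with <I-compare t i
  ... | tri< t<i _ _ = ℚP.<-irrefl (trans (proj₁ lead-α t t<i) (sym (proj₁ lead-β t (<I-trans t<i i<j)))) αt<βt
  ... | tri≈ _ refl _ = ℚP.<-asym (ℚP.<-respʳ-≡ (proj₁ lead-β t i<j) αt<βt) 0<αi
  ... | tri> _ _ i<t = proj₂ lead-α (trans (below i i<t) (proj₁ lead-β i i<j))

integral-lead : ∀ {γ β} → IsInt γ β → Σ I λ i → FirstDev β 0ℚ i × FirstDev γ 1ℚ i × β +G ψe i ≡ γ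
integral-lead {γ} {β} (β≢0 , c , ψβ≡c , β+c≡γ) with i , lead-β ← nonzero-lead β≢0
  with refl ← trans (sym ψβ≡c) (ψG-spec lead-β)
  = i , lead-β , ((λ k k<i → trans (sym (coord-at k)) (coord-α+ψe-below lead-β k<i)) , not-one) , β+c≡γ
  where
  coord-at : ∀ k → coord (β +G ψe i) k ≡ coord γ k
  coord-at k = cong (λ z → coord z k) β+c≡γ
  not-one : coord γ i ≢ 1ℚ
  not-one γi≡1 = proj₂ lead-β (∙-cancelʳ 1ℚ (coord β i) 0ℚ
    (trans (sym (coord-α+ψe-at β i)) (trans (coord-at i) γi≡1)))

integral-exists : ∀ γ → Σ G (IsInt γ)
integral-exists γ with i , (below , not-one) ← first-non-one γ =
  β , lead-nonzero lead-β , ψe i , ψG-spec lead-β , -G+G γ (ψe i)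
  where
  β : G
  β = γ +G -G ψe i
  lead-β : FirstDev β 0ℚ i
  lead-β = (λ k k<i → trans (coord-difference (ψe i) γ k)
                        (trans (cong₂ (λ a b → a ℚ.+ ℚ.- b) (below k k<i) (coord-ψe-≤ (inj₁ k<i))) (ℚP.+-inverseʳ 1ℚ))) ,
           (λ β≡0 → not-one (trans (sym (difference-zero (ψe i) γ i β≡0)) (coord-ψe-≤ {i} (inj₂ refl))))

integral-unique : ∀ γ β β′ → IsInt γ β → IsInt γ β′ → β ≡ β′
integral-unique γ β β′ int int′
  with i , _ , non-one-i , β+ψ≡γ ← integral-lead int | j , _ , non-one-j , β′+ψ≡γ ← integral-lead int′
  with refl ← FirstDeviation-unique <I-compare non-one-i non-one-j
  = trans (+G-cancelʳ β (ψe i) γ β+ψ≡γ) (sym (+G-cancelʳ β′ (ψe i) γ β′+ψ≡γ))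

ψG-integral : ∀ γ β → IsInt γ β → ψG β ≡ just (sG γ)
ψG-integral γ β int with i , lead-β , non-one , _ ← integral-lead int =
  trans (ψG-spec lead-β) (cong (just ∘ ψe) (sym (s-index-spec non-one)))

Ψ-element : ∀ {x} → InΨ x → Σ I λ j → x ≡ ψe j
Ψ-element (_ , _ , ψα≡x) with j , _ , refl ← ψG-just ψα≡x = j , refl

-- ψe j = ψ(x) for the indicator function x of {j}
ψe∈Ψ : ∀ j → InΨ (ψe j)
ψe∈Ψ j with pred? j in pred≡
... | nothing with refl ← pred?-nothing pred≡ = ψe (nat 0) , lead-nonzero lead₀ , ψG-spec lead₀
  where
  lead₀ : FirstDev (ψe (nat 0)) 0ℚ (nat 0)
  lead₀ = (λ { _ (₁∼₁ ()) }) , (λ ())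
... | just i = subst (InΨ ∘ ψe) (pred?-just pred≡) (jump , lead-nonzero lead-jump , ψG-spec lead-jump)
  where
  jump : G
  jump = ψe (sucI i) +G -G ψe i
  lead-jump : FirstDev jump 0ℚ (sucI i)
  lead-jump =
    (λ k k<1+i → trans (coord-difference (ψe i) (ψe (sucI i)) k)
       (trans (cong₂ (λ a b → a ℚ.+ ℚ.- b) (coord-ψe-≤ (inj₁ k<1+i)) (coord-ψe-≤ (<sucI⇒≤ k<1+i))) (ℚP.+-inverseʳ 1ℚ))) ,
    (λ jump≡0 → ℚP.<-irrefl (trans (sym (coord-ψe-> (<sucI i)))
                               (trans (difference-zero (ψe i) (ψe (sucI i)) (sucI i) jump≡0) (coord-ψe-≤ {sucI i} (inj₂ refl)))) 0<1)

sG-0-positive : 0G <G sG 0G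
sG-0-positive = subst (0G <G_) (sym sG-0) (nat 0 , (λ { _ (₁∼₁ ()) }) , 0<1)

sG-0-least : ∀ x → InΨ x → sG 0G ≤G x
sG-0-least x x∈Ψ with j , refl ← Ψ-element x∈Ψ = subst (_≤G ψe j) (sym sG-0) (ψe-mono-≤ (nat0-≤I j))

sG-0<ψe-sucI : ∀ i → sG 0G <G ψe (sucI i)
sG-0<ψe-sucI i = subst (_<G ψe (sucI i)) (sym sG-0) (ψe-mono (≤<I-trans (nat0-≤I i) (<sucI i)))

sG-Ψ : ∀ α → InΨ α → InΨ (sG α)
sG-Ψ α α∈Ψ with i , refl ← Ψ-element α∈Ψ = subst InΨ (sym (sG-ψe i)) (ψe∈Ψ (sucI i))

sG-increasing : ∀ α → InΨ α → α <G sG α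
sG-increasing α α∈Ψ with i , refl ← Ψ-element α∈Ψ = subst (ψe i <G_) (sym (sG-ψe i)) (ψe-mono (<sucI i))

sG-immediate : ∀ α x → InΨ α → InΨ x → α <G x → sG α ≤G x
sG-immediate α x α∈Ψ x∈Ψ α<x with i , refl ← Ψ-element α∈Ψ | j , refl ← Ψ-element x∈Ψ =
  subst (_≤G ψe j) (sym (sG-ψe i)) (ψe-mono-≤ (sucI-least (ψe-reflects-< α<x)))

sG-injective : ∀ α β → InΨ α → InΨ β → sG α ≡ sG β → α ≡ β
sG-injective α β α∈Ψ β∈Ψ sα≡sβ with i , refl ← Ψ-element α∈Ψ | j , refl ← Ψ-element β∈Ψ =
  cong ψe (sucI-injective (ψe-injective (trans (sym (sG-ψe i)) (trans sα≡sβ (sG-ψe j)))))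

sG-surjective : ∀ y → InΨ y → sG 0G <G y → Σ G λ x → InΨ x × sG x ≡ y
sG-surjective y y∈Ψ s0<y with j , refl ← Ψ-element y∈Ψ | pred? j in pred≡
... | just i = ψe i , ψe∈Ψ i , trans (sG-ψe i) (cong ψe (pred?-just pred≡))
... | nothing with refl ← pred?-nothing pred≡ = ⊥-elim (<G-irrefl _ (subst (_<G ψe (nat 0)) sG-0 s0<y))

pG-sG : ∀ x → InΨ x → pG (sG x) ≡ just x
pG-sG x x∈Ψ with i , refl ← Ψ-element x∈Ψ = trans (cong pG (sG-ψe i)) (pG-ψe-sucI i)

pG-outside : ∀ y → ¬ (InΨ y × sG 0G <G y) → pG y ≡ nothing
pG-outside y not-in with pG y in p≡
... | nothing = refl
... | just z with i , y≡ψ , _ ← pG-just p≡ =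
  ⊥-elim (not-in (subst InΨ (sym y≡ψ) (ψe∈Ψ (sucI i)) , subst (sG 0G <G_) (sym y≡ψ) (sG-0<ψe-sucI i)))

Γlog-isTlog : IsTlog Γlog-raw
Γlog-isTlog = record
  { +-assoc    = +G-assoc
  ; +-comm     = +G-comm
  ; +-identity = +G-identityˡ
  ; +-inverse  = +G-inverseˡ
  ; <-irrefl   = <G-irrefl
  ; <-trans    = <G-trans
  ; <-tri      = <G-trichotomy
  ; <-+        = <G-+
  ; δ-div      = δG-divides
  ; ψ-0        = ψG-0
  ; ψ-fin      = λ α α≢0 → ψe (proj₁ (nonzero-lead α≢0)) , ψG-spec (proj₂ (nonzero-lead α≢0))
  ; AC1        = ψG-AC1
  ; AC2        = ψG-AC2
  ; AC3        = ψG-AC3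
  ; Htype      = ψG-Htype
  ; int-exists = integral-exists
  ; int-unique = integral-unique
  ; s-def      = ψG-integral
  ; s0-pos     = sG-0-positive
  ; s0-least   = sG-0-least
  ; s-succ-in  = sG-Ψ
  ; s-succ-gt  = sG-increasing
  ; s-succ-imm = sG-immediate
  ; s-inj      = sG-injective
  ; s-surj     = sG-surjective
  ; p-inv      = pG-sG
  ; p-out      = pG-outside
  }

Γlog : TlogModel
Γlog = record { raw = Γlog-raw ; isTlog = Γlog-isTlog }

-- Automorphisms induced by reindexing I

open Automorphisms Γlog

record Reindexing : Set where
  field
    τ τ⁻¹    : I → I
    τ⁻¹-mono : ∀ {i j} → i <I j → τ⁻¹ i <I τ⁻¹ j
    τ⁻¹-τ    : ∀ i → τ⁻¹ (τ i) ≡ i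
    τ-sucI   : ∀ i → τ (sucI i) ≡ sucI (τ i)
    σ        : G → G
    coord-σ  : ∀ x k → coord (σ x) k ≡ coord x (τ⁻¹ k)

module ReindexingProperties (R : Reindexing) where
  open Reindexing R

  σ-+ : ∀ x y → σ (x +G y) ≡ σ x +G σ y
  σ-+ x y = coord-injective λ k →
    trans (coord-σ _ k) (trans (coord-+ x y (τ⁻¹ k)) (sym (trans (coord-+ (σ x) (σ y) k) (cong₂ ℚ._+_ (coord-σ x k) (coord-σ y k)))))

  σ-- : ∀ x → σ (-G x) ≡ -G σ x
  σ-- x = coord-injective λ k →
    trans (coord-σ _ k) (trans (coord-- x (τ⁻¹ k)) (sym (trans (coord-- (σ x) k) (cong ℚ.-_ (coord-σ x k)))))

  σ-0 : σ 0G ≡ 0G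
  σ-0 = coord-injective λ k → trans (coord-σ _ k) (trans (coord-0 (τ⁻¹ k)) (sym (coord-0 k)))

  σ-* : ∀ c x → σ (c *G x) ≡ c *G σ x
  σ-* c x = coord-injective λ k →
    trans (coord-σ _ k) (trans (coord-* c x (τ⁻¹ k)) (sym (trans (coord-* c (σ x) k) (cong (c ℚ.*_) (coord-σ x k)))))

  below-τ : ∀ {k i} → k <I τ i → τ⁻¹ k <I i
  below-τ {k} {i} k<τi = subst (τ⁻¹ k <I_) (τ⁻¹-τ i) (τ⁻¹-mono k<τi)

  coord-σ-τ : ∀ x i → coord (σ x) (τ i) ≡ coord x i
  coord-σ-τ x i = trans (coord-σ x (τ i)) (cong (coord x) (τ⁻¹-τ i))

  σ-FirstDev : ∀ {x c i} → FirstDev x c i → FirstDev (σ x) c (τ i)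
  σ-FirstDev {x} {c} {i} (below , at-i) =
    (λ k k<τi → trans (coord-σ x k) (below _ (below-τ k<τi))) , (at-i ∘ trans (sym (coord-σ-τ x i)))

  σ-ψe : ∀ i → σ (ψe i) ≡ ψe (τ i)
  σ-ψe i = coord-injective λ k → trans (coord-σ (ψe i) k) (compare k)
    where
    compare : ∀ k → coord (ψe i) (τ⁻¹ k) ≡ coord (ψe (τ i)) k
    compare k with <I-compare k (τ i)
    ... | tri< k<τi _ _ = trans (coord-ψe-≤ (inj₁ (below-τ k<τi))) (sym (coord-ψe-≤ (inj₁ k<τi)))
    ... | tri≈ _ refl _ = trans (coord-ψe-≤ (inj₂ (τ⁻¹-τ i))) (sym (coord-ψe-≤ {τ i} (inj₂ refl)))
    ... | tri> _ _ τi<k = trans (coord-ψe-> (subst (_<I τ⁻¹ k) (τ⁻¹-τ i) (τ⁻¹-mono τi<k))) (sym (coord-ψe-> τi<k))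

  σ-ψ : ∀ x → ψG (σ x) ≡ Maybe.map σ (ψG x)
  σ-ψ x with x ≟G 0G
  ... | yes refl = trans (cong ψG σ-0) (trans ψG-0 (cong (Maybe.map σ) (sym ψG-0)))
  ... | no x≢0 with i , lead ← nonzero-lead x≢0 =
    trans (ψG-spec (σ-FirstDev lead)) (trans (cong just (sym (σ-ψe i))) (cong (Maybe.map σ) (sym (ψG-spec lead))))

  σ-s : ∀ x → sG (σ x) ≡ σ (sG x)
  σ-s x = trans (cong ψe (s-index-spec (σ-FirstDev (proj₂ (first-non-one x))))) (sym (σ-ψe (s-index x)))

  σ-< : ∀ {x y} → x <G y → σ x <G σ y
  σ-< {x} {y} (i , below , x<y) =
    τ i , (λ k k<τi → trans (coord-σ x k) (trans (below _ (below-τ k<τi)) (sym (coord-σ y k)))) ,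
    subst₂ ℚ._<_ (sym (coord-σ-τ x i)) (sym (coord-σ-τ y i)) x<y

  σ-pG-ψe-sucI : ∀ i → pG (σ (ψe (sucI i))) ≡ just (σ (ψe i))
  σ-pG-ψe-sucI i = trans (cong pG (trans (σ-ψe (sucI i)) (cong ψe (τ-sucI i))))
                         (trans (pG-ψe-sucI (τ i)) (cong just (sym (σ-ψe i))))

reindexing-automorphism : (A B : Reindexing) → (∀ k → Reindexing.τ⁻¹ B k ≡ Reindexing.τ A k) →
                          (∀ k → Reindexing.τ⁻¹ A k ≡ Reindexing.τ B k) → Automorphism
reindexing-automorphism A B τ⁻¹B≗τA τ⁻¹A≗τB = record
  { f     = σA
  ; f⁻¹   = σB
  ; f⁻¹-f = σB-σA
  ; f-f⁻¹ = σA-σB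
  ; f-0   = PA.σ-0
  ; f-+   = PA.σ-+
  ; f--   = PA.σ--
  ; f-δ   = λ n x → PA.σ-* (1/suc n) x
  ; f-ψ   = PA.σ-ψ
  ; f-s   = PA.σ-s
  ; f-p   = σA-p
  ; f-<   = PA.σ-<
  ; f-<⁻¹ = λ {x} {y} σx<σy → subst₂ _<G_ (σB-σA x) (σB-σA y) (PB.σ-< σx<σy)
  }
  where
  module PA = ReindexingProperties A
  module PB = ReindexingProperties B
  open Reindexing A using () renaming (σ to σA; coord-σ to coord-σA; τ⁻¹ to τA⁻¹; τ⁻¹-τ to τA⁻¹-τA)
  open Reindexing B using () renaming (σ to σB; coord-σ to coord-σB; τ⁻¹ to τB⁻¹; τ⁻¹-τ to τB⁻¹-τB; τ-sucI to τB-sucI)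
  σB-σA : ∀ x → σB (σA x) ≡ x
  σB-σA x = coord-injective λ k →
    trans (coord-σB _ k) (trans (coord-σA x _) (cong (coord x) (trans (cong τA⁻¹ (τ⁻¹B≗τA k)) (τA⁻¹-τA k))))
  σA-σB : ∀ x → σA (σB x) ≡ x
  σA-σB x = coord-injective λ k →
    trans (coord-σA _ k) (trans (coord-σB x _) (cong (coord x) (trans (cong τB⁻¹ (τ⁻¹A≗τB k)) (τB⁻¹-τB k))))
  σA-p : ∀ y → pG (σA y) ≡ Maybe.map σA (pG y)
  σA-p y with pG y in p≡
  ... | just z with i , y≡ψ , z≡ψ ← pG-just p≡ =
    trans (cong (pG ∘ σA) y≡ψ) (trans (PA.σ-pG-ψe-sucI i) (cong (just ∘ σA) (sym z≡ψ)))
  ... | nothing with pG (σA y) in σp≡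
  ...   | nothing = refl
  ...   | just w with i , σy≡ψ , _ ← pG-just σp≡ = case (trans (sym p≡) (trans (cong pG y≡) (pG-ψe-sucI _)))
    where
    y≡ : y ≡ ψe (sucI (Reindexing.τ B i))
    y≡ = trans (sym (σB-σA y)) (trans (cong σB σy≡ψ) (trans (PB.σ-ψe (sucI i)) (cong ψe (τB-sucI i))))
    case : nothing ≡ just (ψe (Reindexing.τ B i)) → just w ≡ nothing
    case ()

-- shiftᴮ l r moves all values of a block up by one place; the new entry at + 0 is the old value at -[1+ 0 ],
-- stored relative to the limit r
shiftᴮ shiftᴮ⁻¹ : ℚ → ℚ → ZBlock → ZBlock
shiftᴮ l r b = zblock (tailₛ (neg b)) ((neg b ! 0 ℚ.+ l ℚ.+ ℚ.- r) ∷ₛ pos b)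
shiftᴮ⁻¹ l r b = zblock ((pos b ! 0 ℚ.+ r ℚ.+ ℚ.- l) ∷ₛ neg b) (tailₛ (pos b))

zcoord-shiftᴮ : ∀ l r b j → zcoord l r (shiftᴮ l r b) j ≡ zcoord l r b (ℤ.pred j)
zcoord-shiftᴮ l r b -[1+ m ] = cong (ℚ._+ l) (tailₛ-! (neg b) m)
zcoord-shiftᴮ l r b (+ zero) = trans (cong (ℚ._+ r) (∷ₛ-!-zero _ (pos b))) (//-rightDividesˡ r (neg b ! 0 ℚ.+ l))
zcoord-shiftᴮ l r b (+ suc m) = cong (ℚ._+ r) (∷ₛ-!-suc _ (pos b) m)

zcoord-shiftᴮ⁻¹ : ∀ l r b j → zcoord l r (shiftᴮ⁻¹ l r b) j ≡ zcoord l r b (ℤ.suc j)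
zcoord-shiftᴮ⁻¹ l r b -[1+ zero ] = trans (cong (ℚ._+ l) (∷ₛ-!-zero _ (neg b))) (//-rightDividesˡ l (pos b ! 0 ℚ.+ r))
zcoord-shiftᴮ⁻¹ l r b -[1+ suc m ] = cong (ℚ._+ l) (∷ₛ-!-suc _ (neg b) m)
zcoord-shiftᴮ⁻¹ l r b (+ m) = cong (ℚ._+ r) (tailₛ-! (pos b) m)

shift₀ shift₀⁻¹ shift₁ shift₁⁻¹ : Reindexing
shift₀ = record
  { τ = Sum.map₂ (Sum.map₁ ℤ.suc) ; τ⁻¹ = Sum.map₂ (Sum.map₁ ℤ.pred)
  ; τ⁻¹-mono = ⊎-<-map-mono id (⊎-<-map-mono ℤ-pred-mono id)
  ; τ⁻¹-τ = λ { (nat n) → refl ; (z₀ j) → cong z₀ (ℤP.pred-suc j) ; (z₁ j) → refl }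
  ; τ-sucI = λ { (nat n) → refl ; (z₀ j) → refl ; (z₁ j) → refl }
  ; σ = λ x → record x { blk₀ = shiftᴮ (ℓ₀ x) (ℓ₁ x) (blk₀ x) }
  ; coord-σ = λ { x (nat n) → refl ; x (z₀ j) → zcoord-shiftᴮ (ℓ₀ x) (ℓ₁ x) (blk₀ x) j ; x (z₁ j) → refl }
  }
shift₀⁻¹ = record
  { τ = Sum.map₂ (Sum.map₁ ℤ.pred) ; τ⁻¹ = Sum.map₂ (Sum.map₁ ℤ.suc)
  ; τ⁻¹-mono = ⊎-<-map-mono id (⊎-<-map-mono ℤ-suc-mono id)
  ; τ⁻¹-τ = λ { (nat n) → refl ; (z₀ j) → cong z₀ (ℤP.suc-pred j) ; (z₁ j) → refl }
  ; τ-sucI = λ { (nat n) → refl ; (z₀ j) → cong z₀ (ℤ-pred-suc-comm j) ; (z₁ j) → refl }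
  ; σ = λ x → record x { blk₀ = shiftᴮ⁻¹ (ℓ₀ x) (ℓ₁ x) (blk₀ x) }
  ; coord-σ = λ { x (nat n) → refl ; x (z₀ j) → zcoord-shiftᴮ⁻¹ (ℓ₀ x) (ℓ₁ x) (blk₀ x) j ; x (z₁ j) → refl }
  }
shift₁ = record
  { τ = Sum.map₂ (Sum.map₂ ℤ.suc) ; τ⁻¹ = Sum.map₂ (Sum.map₂ ℤ.pred)
  ; τ⁻¹-mono = ⊎-<-map-mono id (⊎-<-map-mono id ℤ-pred-mono)
  ; τ⁻¹-τ = λ { (nat n) → refl ; (z₀ j) → refl ; (z₁ j) → cong z₁ (ℤP.pred-suc j) }
  ; τ-sucI = λ { (nat n) → refl ; (z₀ j) → refl ; (z₁ j) → refl }
  ; σ = λ x → record x { blk₁ = shiftᴮ (ℓ₁ x) 0ℚ (blk₁ x) }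
  ; coord-σ = λ { x (nat n) → refl ; x (z₀ j) → refl ; x (z₁ j) → zcoord-shiftᴮ (ℓ₁ x) 0ℚ (blk₁ x) j }
  }
shift₁⁻¹ = record
  { τ = Sum.map₂ (Sum.map₂ ℤ.pred) ; τ⁻¹ = Sum.map₂ (Sum.map₂ ℤ.suc)
  ; τ⁻¹-mono = ⊎-<-map-mono id (⊎-<-map-mono id ℤ-suc-mono)
  ; τ⁻¹-τ = λ { (nat n) → refl ; (z₀ j) → refl ; (z₁ j) → cong z₁ (ℤP.suc-pred j) }
  ; τ-sucI = λ { (nat n) → refl ; (z₀ j) → refl ; (z₁ j) → cong z₁ (ℤ-pred-suc-comm j) }
  ; σ = λ x → record x { blk₁ = shiftᴮ⁻¹ (ℓ₁ x) 0ℚ (blk₁ x) }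
  ; coord-σ = λ { x (nat n) → refl ; x (z₀ j) → refl ; x (z₁ j) → zcoord-shiftᴮ⁻¹ (ℓ₁ x) 0ℚ (blk₁ x) j }
  }

translate₀ translate₁ : Automorphism
translate₀ = reindexing-automorphism shift₀ shift₀⁻¹ (λ _ → refl) (λ _ → refl)
translate₁ = reindexing-automorphism shift₁ shift₁⁻¹ (λ _ → refl) (λ _ → refl)

-- Failure of exchange

-- b is the sum of the indicator functions of the points 0 of both copies of ℤ; its leading index is the
-- point 0 of the first copy, so ψ(b) = a
a b : G
a = ψe (z₀ (+ 0))
b = mkG 0ℚ 0ℚ 0ₛ point point
  where
  point : ZBlock
  point = zblock 0ₛ (replicateₛ 1 1ℚ)

ψb≡a : ψG b ≡ just a
ψb≡a = ψG-spec {b} {z₀ (+ 0)} (below , (λ ()))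
  where
  below : ∀ k → k <I z₀ (+ 0) → coord b k ≡ 0ℚ
  below (nat n) _ = refl
  below (z₀ -[1+ m ]) _ = refl
  below (z₀ (+ n)) (₂∼₂ (₁∼₁ (+<+ ())))
  below (z₁ j) (₂∼₂ ())

a<translate₀-a : a <G Automorphism.f translate₀ a
a<translate₀-a = subst (a <G_) (sym (ReindexingProperties.σ-ψe shift₀ (z₀ (+ 0))))
  (ψe-mono {z₀ (+ 0)} {z₀ (+ 1)} (₂∼₂ (₁∼₁ (+<+ (s≤s z≤n)))))

translate₁-b<b : Automorphism.f translate₁ b <G b
translate₁-b<b = z₁ (+ 0) , agree , 0<1
  where
  agree : ∀ k → k <I z₁ (+ 0) → coord (Automorphism.f translate₁ b) k ≡ coord b k
  agree (nat n) _ = refl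
  agree (z₀ j) _ = refl
  agree (z₁ -[1+ m ]) _ = refl
  agree (z₁ (+ n)) (₂∼₂ (₂∼₂ (+<+ ())))

translate₁-fixes-a : Automorphism.f translate₁ a ≡ a
translate₁-fixes-a = ReindexingProperties.σ-ψe shift₁ (z₀ (+ 0))

proposition7p2 : ¬ TlogHasExchange
proposition7p2 exchange = b∉acl⟨a⟩ (proj₁ (exchange Γlog ∅ (just a) (just b) a∉acl∅ b∉acl∅) a∈acl⟨b⟩)
  where
  open Semantics Γlog
  ∅ : Subset
  ∅ _ = ⊥
  a∉acl∅ : ¬ acl ∅ (just a)
  a∉acl∅ = moved⇒∉acl {A = ∅} translate₀ (λ ()) (inj₁ a<translate₀-a)
  b∉acl∅ : ¬ acl ∅ (just b)
  b∉acl∅ = moved⇒∉acl {A = ∅} translate₁ (λ ()) (inj₂ translate₁-b<b)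
  b∉acl⟨a⟩ : ¬ acl (∅ ∪｛ just a ｝) (just b)
  b∉acl⟨a⟩ = moved⇒∉acl {A = ∅ ∪｛ just a ｝} translate₁ (λ { (inj₂ refl) → cong just translate₁-fixes-a })
    (inj₂ translate₁-b<b)
  a∈acl⟨b⟩ : acl (∅ ∪｛ just b ｝) (just a)
  a∈acl⟨b⟩ = ψ-value∈acl {A = ∅ ∪｛ just b ｝} (inj₂ refl) ψb≡a
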